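{- Let $G$ be a finite group of order $v$ containing a regular $(v,k,\lambda,\mu)$-partial difference set $D$, where $0<\mu<k$, $\Delta=(\lambda-\mu)^2+4(k-\mu)$ is a perfect square, and $(v,k,\lambda,\mu)$ is not of the form $(v,(v-1)/2,(v-5)/4,(v-1)/4)$. Let $\xi$ be a nonprincipal linear character of $G$ of prime order $p$, with kernel $N$. Then $p$ divides $k-\xi(D)$, $|N\cap D|=\frac{k-\xi(D)}{p}+\xi(D)$, and $|Na\cap D|=\frac{k-\xi(D)}{p}$ for every $a\notin N$.
   Context: A subset $D$ of a finite group $G$ of order $v$ with $|D|=k$ is a $(v,k,\lambda,\mu)$-partial difference set if every nonidentity element of $D$ can be written as $xy^{ -1}$ with $x,y\in D$ in exactly $\lambda$ ways, and every nonidentity element of $G\setminus D$ in exactly $\mu$ ways; it is regular if $D=\{d^{ -1}:d\in D\}$ and $1\notin D$. $\xi(D)=\sum_{d\in D}\xi(d)$; a linear character is a homomorphism $G\to\mathbb{C}^\times$. -}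

module Defs where

open import Data.Nat using (ℕ; zero; suc; _+_; NonZero; _≟_)
open import Data.Nat.DivMod using (_%_)
open import Data.Fin using (Fin; toℕ) renaming (zero to fzero; suc to fsuc)
open import Data.Fin.Properties using () renaming (_≟_ to _≟ᶠ_)
open import Data.Bool using (Bool; true; false; if_then_else_; _∧_; not)
open import Data.Integer using (ℤ; +_; _-_; _*_)
open import Data.Product using (∃)
open import Relation.Nullary.Decidable using (⌊_⌋)
open import Relation.Nullary using (¬_)
open import Relation.Binary.PropositionalEquality using (_≡_)
open import Algebra.Structures using (IsGroup)
open import Function using (_∘_)

-- A finite group of order v, presented on the carrier Fin v
-- (every finite group of order v is isomorphic to one of these).
record FiniteGroup (v : ℕ) : Set where
  infixl 7 _·_
  field
    _·_     : Fin v → Fin v → Fin v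
    ε       : Fin v
    _⁻¹     : Fin v → Fin v
    isGroup : IsGroup _≡_ _·_ ε _⁻¹

card : ∀ {n} → (Fin n → Bool) → ℕ
card {zero}  f = 0
card {suc n} f = (if f fzero then 1 else 0) + card (f ∘ fsuc)

card₂ : ∀ {m n} → (Fin m → Fin n → Bool) → ℕ
card₂ {zero}  f = 0
card₂ {suc m} f = card (f fzero) + card₂ (f ∘ fsuc)

module _ {v : ℕ} (G : FiniteGroup v) where
  open FiniteGroup G

  reps : (Fin v → Bool) → Fin v → ℕ
  reps D g = card₂ (λ x y → D x ∧ D y ∧ ⌊ (x · (y ⁻¹)) ≟ᶠ g ⌋)

  record IsPDS (D : Fin v → Bool) (k lam mu : ℕ) : Set where
    field
      size : card D ≡ k
      inD  : ∀ g → ¬ (g ≡ ε) → D g ≡ true  → reps D g ≡ lam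
      outD : ∀ g → ¬ (g ≡ ε) → D g ≡ false → reps D g ≡ mu

  record IsRegular (D : Fin v → Bool) : Set where
    field
      symm   : ∀ g → D (g ⁻¹) ≡ D g
      noUnit : D ε ≡ false

  -- A group homomorphism φ : G → ℤ/pℤ (ℤ/pℤ = Fin p under addition mod p).
  -- A linear character ξ of G with values in the p-th roots of unity is
  -- exactly ξ(g) = ζ^φ(g) for such a φ (ζ a fixed primitive p-th root of 1).
  IsHomToZp : (p : ℕ) → .{{NonZero p}} → (Fin v → Fin p) → Set
  IsHomToZp p φ = ∀ x y → toℕ (φ (x · y)) ≡ (toℕ (φ x) + toℕ (φ y)) % p

  inKer : ∀ {p} → (Fin v → Fin p) → Fin v → Bool
  inKer φ g = ⌊ toℕ (φ g) ≟ 0 ⌋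

  inCoset : ∀ {p} → (Fin v → Fin p) → Fin v → Fin v → Bool
  inCoset φ a g = inKer φ (g · (a ⁻¹))

  -- ξ(D) = Σ_{d ∈ D} ζ^φ(d), as an element of ℤ[C_p] = (Fin p → ℤ):
  -- coefficient of ζ^i is #{d ∈ D : φ(d) = i}.
  charSum : ∀ {p} → (Fin v → Fin p) → (Fin v → Bool) → Fin p → ℤ
  charSum φ D i = + card (λ d → D d ∧ ⌊ φ d ≟ᶠ i ⌋)

-- ℤ[ζ_p] = ℤ[C_p] / (1 + ζ + … + ζ^(p-1)); the ideal generated by the norm
-- element is ℤ·(1 + ζ + … + ζ^(p-1)), so two elements are equal in ℤ[ζ_p]
-- iff their coefficient difference is a constant vector.
-- "x equals the integer t in ℤ[ζ_p]":
_≈ℤ_ : ∀ {p} → (Fin p → ℤ) → ℤ → Set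
_≈ℤ_ {p} x t = ∃ λ c → ∀ (i : Fin p) → x i - (if ⌊ toℕ i ≟ 0 ⌋ then t else + 0) ≡ c

{-# OPTIONS --safe #-}
module Submission where

-- A nonprincipal character ξ = ζ^φ of prime order p maps ℤ[G] onto ℤ[ζₚ], modelled here as the group ring
-- ℤ[Cₚ] = (Fin p → ℤ) modulo the constant vectors, i.e. modulo the norm element 1 + X + ⋯ + X^(p−1).
-- Applying ξ to the partial difference set equation D D⁽⁻¹⁾ = k + λD + μ(G − D − 1), where D⁽⁻¹⁾ = D and
-- ξ(G) = 0, gives ξ(D)² = (λ − μ) ξ(D) + (k − μ). As Δ is a square, this quadratic has integer roots, and as
-- ℤ[ζₚ] is an integral domain, ξ(D) is one of them, t. So the coefficient vector of ξ(D) is t·(1, 0, …, 0) plus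
-- a constant c, and reading off its coefficients gives |N ∩ D| = c + t, |Na ∩ D| = c and k − t = pc.
--
-- ℤ[ζₚ] is a domain by a descent along π = X − 1: π divides f exactly when p divides the augmentation of f,
-- and π^p ∈ pℤ[ζₚ]. Hence a nonzero f is either p·h with h smaller in the size Σᵢ |fᵢ − f₀|, or π^v times a
-- cofactor whose augmentation is prime to p; augmentation is multiplicative, so two such factors cannot
-- multiply to 0.

open import Data.Nat.Base using (ℕ; NonZero)
open import Data.Nat.Primality using (Prime; prime⇒nonZero; prime⇒nonTrivial)
open import Algebra.Bundles using (CommutativeSemiring)
open import Data.Fin.Base using (Fin)
open import Defs using (FiniteGroup; IsHomToZp; IsPDS; IsRegular; card; card₂; reps; charSum; inKer; inCoset; _≈ℤ_)

module IntegerSums where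

  open import Data.Nat.Base using (zero; suc; _≡ᵇ_)
  open import Data.Bool.Base using (Bool; true; false; if_then_else_; _∧_)
  open import Data.Fin.Base using (zero; suc; toℕ)
  open import Data.Fin.Properties using (_≟_)
  open import Data.Fin.Permutation using (permutation)
  open import Data.Integer.Base using (ℤ; +_; -1ℤ; _+_; _*_; -_; _-_)
  import Data.Integer.Properties as ℤ
  open import Data.Integer.Tactic.RingSolver using (solve-∀)
  open import Relation.Nullary.Decidable using (Dec; ⌊_⌋; yes; no; isYes≗does; does-⇔)
  open import Relation.Nullary.Negation using (contradiction)
  open import Relation.Binary.PropositionalEquality
  open import Function.Base using (_∘_)
  open import Function.Bundles using (mk⇔)

  open import Algebra.Properties.Semiring.Sum ℤ.+-*-semiring public
    using (sum; sum-syntax; sum-cong-≗; ∑-distrib-+; ∑-comm; *-distribˡ-sum; *-distribʳ-sum)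
  open import Algebra.Properties.Semiring.Sum ℤ.+-*-semiring
    using (sum-permute)

  ⟦_⟧ : Bool → ℤ
  ⟦ b ⟧ = if b then + 1 else + 0

  ⟦b⟧*⟦b⟧≡⟦b⟧ : ∀ b → ⟦ b ⟧ * ⟦ b ⟧ ≡ ⟦ b ⟧
  ⟦b⟧*⟦b⟧≡⟦b⟧ true  = refl
  ⟦b⟧*⟦b⟧≡⟦b⟧ false = refl

  ⟦a∧b⟧≡⟦a⟧*⟦b⟧ : ∀ a b → ⟦ a ∧ b ⟧ ≡ ⟦ a ⟧ * ⟦ b ⟧
  ⟦a∧b⟧≡⟦a⟧*⟦b⟧ true  b = sym (ℤ.*-identityˡ ⟦ b ⟧)
  ⟦a∧b⟧≡⟦a⟧*⟦b⟧ false b = refl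

  card-sum : ∀ {n} (P : Fin n → Bool) → + card P ≡ sum (⟦_⟧ ∘ P)
  card-sum {zero}  P = refl
  card-sum {suc n} P = trans (ℤ.pos-+ _ (card (P ∘ suc))) (cong₂ _+_ (head (P zero)) (card-sum (P ∘ suc)))
    where
    head : ∀ b → + (if b then 1 else 0) ≡ ⟦ b ⟧
    head true  = refl
    head false = refl

  card₂-sum : ∀ {m n} (P : Fin m → Fin n → Bool) → + card₂ P ≡ sum (λ i → sum (⟦_⟧ ∘ P i))
  card₂-sum {zero}  P = refl
  card₂-sum {suc m} P = trans (ℤ.pos-+ (card (P zero)) (card₂ (P ∘ suc))) (cong₂ _+_ (card-sum (P zero)) (card₂-sum (P ∘ suc)))

  δ : ∀ {n} → Fin n → Fin n → ℤ
  δ i j = ⟦ ⌊ i ≟ j ⌋ ⟧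

  δ-suc : ∀ {n} (i j : Fin n) → δ (suc i) (suc j) ≡ δ i j
  δ-suc i j with i ≟ j
  ... | yes _ = refl
  ... | no _  = refl

  δ-toℕ : ∀ {n} (i j : Fin n) → δ i j ≡ ⟦ toℕ i ≡ᵇ toℕ j ⟧
  δ-toℕ zero    zero    = refl
  δ-toℕ zero    (suc j) = refl
  δ-toℕ (suc i) zero    = refl
  δ-toℕ (suc i) (suc j) = trans (δ-suc i j) (δ-toℕ i j)

  ⟦⌊⌋⟧-cong-⇔ : ∀ {A B : Set} (a? : Dec A) (b? : Dec B) → (A → B) → (B → A) → ⟦ ⌊ a? ⌋ ⟧ ≡ ⟦ ⌊ b? ⌋ ⟧
  ⟦⌊⌋⟧-cong-⇔ a? b? to from = cong ⟦_⟧ (trans (isYes≗does a?) (trans (does-⇔ (mk⇔ to from) a? b?) (sym (isYes≗does b?))))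

  δ-cong-⇔ : ∀ {m n} {i j : Fin m} {k l : Fin n} → (i ≡ j → k ≡ l) → (k ≡ l → i ≡ j) → δ i j ≡ δ k l
  δ-cong-⇔ {i = i} {j} {k} {l} = ⟦⌊⌋⟧-cong-⇔ (i ≟ j) (k ≟ l)

  δ-refl : ∀ {n} (i : Fin n) → δ i i ≡ + 1
  δ-refl i with i ≟ i
  ... | yes _   = refl
  ... | no i≢i  = contradiction refl i≢i

  δ-≢ : ∀ {n} {i j : Fin n} → i ≢ j → δ i j ≡ + 0
  δ-≢ {i = i} {j} i≢j with i ≟ j
  ... | yes i≡j = contradiction i≡j i≢j
  ... | no _    = refl

  δ-comm : ∀ {n} (i j : Fin n) → δ i j ≡ δ j i
  δ-comm i j = δ-cong-⇔ sym sym

  sum-const : ∀ n c → ∑[ i < n ] c ≡ + n * c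
  sum-const zero    c = refl
  sum-const (suc n) c = trans (cong (_+_ c) (sum-const n c)) (sym (ℤ.suc-* (+ n) c))

  sum-δ : ∀ {n} j (f : Fin n → ℤ) → sum (λ i → δ i j * f i) ≡ f j
  sum-δ {suc n} zero    f = trans (cong₂ _+_ (ℤ.*-identityˡ (f zero)) rest) (ℤ.+-identityʳ (f zero))
    where
    rest : sum (λ i → + 0 * f (suc i)) ≡ + 0
    rest = trans (sum-cong-≗ (λ i → ℤ.*-zeroˡ (f (suc i)))) (trans (sum-const n (+ 0)) (ℤ.*-zeroʳ (+ n)))
  sum-δ (suc j) f = trans (cong₂ _+_ (ℤ.*-zeroˡ (f zero)) shifted) (ℤ.+-identityˡ (f (suc j)))
    where
    shifted : sum (λ i → δ (suc i) (suc j) * f (suc i)) ≡ f (suc j)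
    shifted = trans (sum-cong-≗ (λ i → cong (_* f (suc i)) (δ-suc i j))) (sum-δ j (f ∘ suc))

  sum-collapse₂ : ∀ {m n k} (F : Fin m → Fin n → ℤ) (h : Fin m → Fin n → Fin k) (c : Fin k → ℤ) →
                  ∑[ g < k ] (∑[ x < m ] ∑[ y < n ] (F x y * δ (h x y) g) * c g) ≡ ∑[ x < m ] ∑[ y < n ] (F x y * c (h x y))
  sum-collapse₂ {m} {n} {k} F h c = begin
    ∑[ g < k ] (∑[ x < m ] ∑[ y < n ] (F x y * δ (h x y) g) * c g)
      ≡⟨ sum-cong-≗ (λ g → trans (*-distribʳ-sum (c g) (λ x → ∑[ y < n ] (F x y * δ (h x y) g)))
                                 (sum-cong-≗ (λ x → *-distribʳ-sum (c g) (λ y → F x y * δ (h x y) g)))) ⟩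
    ∑[ g < k ] ∑[ x < m ] ∑[ y < n ] (F x y * δ (h x y) g * c g)
      ≡⟨ ∑-comm (λ g x → ∑[ y < n ] (F x y * δ (h x y) g * c g)) ⟩
    ∑[ x < m ] ∑[ g < k ] ∑[ y < n ] (F x y * δ (h x y) g * c g)
      ≡⟨ sum-cong-≗ (λ x → ∑-comm (λ g y → F x y * δ (h x y) g * c g)) ⟩
    ∑[ x < m ] ∑[ y < n ] ∑[ g < k ] (F x y * δ (h x y) g * c g)
      ≡⟨ sum-cong-≗ (λ x → sum-cong-≗ (λ y → collapse (F x y) (h x y))) ⟩
    ∑[ x < m ] ∑[ y < n ] (F x y * c (h x y))
      ∎
    where
    open ≡-Reasoning
    rearrange : ∀ a d b → a * d * b ≡ d * (a * b)
    rearrange = solve-∀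
    collapse : ∀ a j → ∑[ g < k ] (a * δ j g * c g) ≡ a * c j
    collapse a j = trans (sum-cong-≗ (λ g → trans (rearrange a (δ j g) (c g)) (cong (_* (a * c g)) (δ-comm j g))))
                         (sum-δ j (λ g → a * c g))

  sum-neg : ∀ {n} (f : Fin n → ℤ) → sum (λ i → - f i) ≡ - sum f
  sum-neg f = trans (sum-cong-≗ (λ i → sym (ℤ.-1*i≡-i (f i)))) (trans (sym (*-distribˡ-sum -1ℤ f)) (ℤ.-1*i≡-i (sum f)))

  ∑-distrib-- : ∀ {n} (f g : Fin n → ℤ) → sum (λ i → f i - g i) ≡ sum f - sum g
  ∑-distrib-- f g = trans (∑-distrib-+ f (λ i → - g i)) (cong (_+_ (sum f)) (sum-neg g))

  sum-reindex : ∀ {n} (σ τ : Fin n → Fin n) → (∀ i → σ (τ i) ≡ i) → (∀ i → τ (σ i) ≡ i) →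
                (f : Fin n → ℤ) → sum f ≡ sum (f ∘ σ)
  sum-reindex σ τ στ τσ f = sum-permute f (permutation σ τ στ τσ)

module Modular (p : ℕ) .{{_ : NonZero p}} where

  open import Data.Nat.Base using (zero; suc; pred; _+_; _∸_; _<_; >-nonZero⁻¹)
  import Data.Nat.Properties as ℕ
  open import Data.Nat.DivMod using (_%_; m%n<n; m<n⇒m%n≡m; %-distribˡ-+; n%n≡0)
  open import Data.Fin.Base using (toℕ; fromℕ<)
  open import Data.Fin.Properties using (toℕ-fromℕ<; toℕ-injective; toℕ<n)
  open import Algebra.Bundles using (AbelianGroup)
  open import Level using (0ℓ)
  open import Algebra.Consequences.Propositional using (comm∧idˡ⇒id; comm∧invˡ⇒inv)
  open import Relation.Binary.PropositionalEquality
  open ≡-Reasoning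

  reduce : ℕ → Fin p
  reduce n = fromℕ< (m%n<n n p)

  toℕ-reduce : ∀ n → toℕ (reduce n) ≡ n % p
  toℕ-reduce n = toℕ-fromℕ< (m%n<n n p)

  toℕ-reduce-< : ∀ {n} → n < p → toℕ (reduce n) ≡ n
  toℕ-reduce-< n<p = trans (toℕ-reduce _) (m<n⇒m%n≡m n<p)

  reduce-toℕ : ∀ a → reduce (toℕ a) ≡ a
  reduce-toℕ a = toℕ-injective (toℕ-reduce-< (toℕ<n a))

  infixl 6 _+ₚ_ _-ₚ_

  _+ₚ_ : Fin p → Fin p → Fin p
  a +ₚ b = reduce (toℕ a + toℕ b)

  negₚ : Fin p → Fin p
  negₚ a = reduce (p ∸ toℕ a)

  _-ₚ_ : Fin p → Fin p → Fin p
  a -ₚ b = a +ₚ negₚ b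

  0ₚ 1ₚ : Fin p
  0ₚ = reduce 0
  1ₚ = reduce 1

  reduce-+ : ∀ m n → reduce m +ₚ reduce n ≡ reduce (m + n)
  reduce-+ m n = toℕ-injective (begin
    toℕ (reduce m +ₚ reduce n)               ≡⟨ toℕ-reduce _ ⟩
    (toℕ (reduce m) + toℕ (reduce n)) % p    ≡⟨ cong₂ (λ x y → (x + y) % p) (toℕ-reduce m) (toℕ-reduce n) ⟩
    (m % p + n % p) % p                      ≡⟨ %-distribˡ-+ m n p ⟨
    (m + n) % p                              ≡⟨ toℕ-reduce (m + n) ⟨
    toℕ (reduce (m + n))                     ∎)

  reduce[p]≡0ₚ : reduce p ≡ 0ₚ
  reduce[p]≡0ₚ = toℕ-injective (trans (toℕ-reduce p) (trans (n%n≡0 p) (sym (toℕ-reduce-< (>-nonZero⁻¹ p)))))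

  +ₚ-assoc : ∀ a b c → (a +ₚ b) +ₚ c ≡ a +ₚ (b +ₚ c)
  +ₚ-assoc a b c = begin
    reduce (toℕ a + toℕ b) +ₚ c                  ≡⟨ cong (reduce (toℕ a + toℕ b) +ₚ_) (reduce-toℕ c) ⟨
    reduce (toℕ a + toℕ b) +ₚ reduce (toℕ c)     ≡⟨ reduce-+ (toℕ a + toℕ b) (toℕ c) ⟩
    reduce (toℕ a + toℕ b + toℕ c)               ≡⟨ cong reduce (ℕ.+-assoc (toℕ a) (toℕ b) (toℕ c)) ⟩
    reduce (toℕ a + (toℕ b + toℕ c))             ≡⟨ reduce-+ (toℕ a) (toℕ b + toℕ c) ⟨
    reduce (toℕ a) +ₚ reduce (toℕ b + toℕ c)     ≡⟨ cong (_+ₚ (b +ₚ c)) (reduce-toℕ a) ⟩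
    a +ₚ (b +ₚ c)                                ∎

  +ₚ-comm : ∀ a b → a +ₚ b ≡ b +ₚ a
  +ₚ-comm a b = cong reduce (ℕ.+-comm (toℕ a) (toℕ b))

  +ₚ-identityˡ : ∀ a → 0ₚ +ₚ a ≡ a
  +ₚ-identityˡ a = begin
    0ₚ +ₚ a                ≡⟨ cong (0ₚ +ₚ_) (reduce-toℕ a) ⟨
    reduce 0 +ₚ reduce (toℕ a) ≡⟨ reduce-+ 0 (toℕ a) ⟩
    reduce (toℕ a)         ≡⟨ reduce-toℕ a ⟩
    a                      ∎

  negₚ-inverseˡ : ∀ a → negₚ a +ₚ a ≡ 0ₚ
  negₚ-inverseˡ a = begin
    negₚ a +ₚ a                          ≡⟨ cong (negₚ a +ₚ_) (reduce-toℕ a) ⟨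
    reduce (p ∸ toℕ a) +ₚ reduce (toℕ a) ≡⟨ reduce-+ (p ∸ toℕ a) (toℕ a) ⟩
    reduce (p ∸ toℕ a + toℕ a)         ≡⟨ cong reduce (ℕ.m∸n+n≡m (ℕ.<⇒≤ (toℕ<n a))) ⟩
    reduce p                           ≡⟨ reduce[p]≡0ₚ ⟩
    0ₚ                                 ∎

  ℤ/p : AbelianGroup 0ℓ 0ℓ
  ℤ/p = record
    { Carrier        = Fin p
    ; _≈_            = _≡_
    ; _∙_            = _+ₚ_
    ; ε              = 0ₚ
    ; _⁻¹            = negₚ
    ; isAbelianGroup = record
      { isGroup = record
        { isMonoid = record
          { isSemigroup = record
            { isMagma = record { isEquivalence = isEquivalence ; ∙-cong = cong₂ _+ₚ_ }
            ; assoc   = +ₚ-assoc }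
          ; identity = comm∧idˡ⇒id +ₚ-comm +ₚ-identityˡ }
        ; inverse = comm∧invˡ⇒inv +ₚ-comm negₚ-inverseˡ
        ; ⁻¹-cong = cong negₚ }
      ; comm = +ₚ-comm } }

  open AbelianGroup ℤ/p using (group; identityʳ)
  open import Algebra.Properties.Group group
    using (//-rightDividesˡ; //-rightDividesʳ; ⁻¹-anti-homo-//; x≈z//y; ε⁻¹≈ε)
  open import Algebra.Properties.AbelianGroup ℤ/p using (xyx⁻¹≈y; ⁻¹-∙-comm)

  a+b-a≡b : ∀ a b → a +ₚ b -ₚ a ≡ b
  a+b-a≡b a b = trans (cong (_-ₚ a) (+ₚ-comm a b)) (//-rightDividesʳ a b)

  a-b+b≡a : ∀ a b → a -ₚ b +ₚ b ≡ a
  a-b+b≡a a b = //-rightDividesˡ b a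

  a+b-b≡a : ∀ a b → a +ₚ b -ₚ b ≡ a
  a+b-b≡a a b = //-rightDividesʳ b a

  a+[b-a]≡b : ∀ a b → a +ₚ (b -ₚ a) ≡ b
  a+[b-a]≡b a b = trans (+ₚ-comm a (b -ₚ a)) (a-b+b≡a b a)

  a-[a-b]≡b : ∀ a b → a -ₚ (a -ₚ b) ≡ b
  a-[a-b]≡b a b = begin
    a +ₚ negₚ (a -ₚ b)   ≡⟨ cong (a +ₚ_) (⁻¹-anti-homo-// a b) ⟩
    a +ₚ (b -ₚ a)      ≡⟨ +ₚ-assoc a b (negₚ a) ⟨
    a +ₚ b -ₚ a        ≡⟨ xyx⁻¹≈y a b ⟩
    b                  ∎

  a-[b+c]≡a-b-c : ∀ a b c → a -ₚ (b +ₚ c) ≡ a -ₚ b -ₚ c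
  a-[b+c]≡a-b-c a b c = trans (cong (a +ₚ_) (sym (⁻¹-∙-comm b c))) (sym (+ₚ-assoc a (negₚ b) (negₚ c)))

  a-0≡a : ∀ a → a -ₚ 0ₚ ≡ a
  a-0≡a a = trans (cong (a +ₚ_) ε⁻¹≈ε) (identityʳ a)

  reduce[1+n]-1≡reduce[n] : ∀ n → reduce (suc n) -ₚ 1ₚ ≡ reduce n
  reduce[1+n]-1≡reduce[n] n = sym (x≈z//y (reduce n) 1ₚ (reduce (suc n))
    (trans (reduce-+ n 1) (cong reduce (ℕ.+-comm n 1))))

  toℕ-0ₚ : toℕ 0ₚ ≡ 0
  toℕ-0ₚ = toℕ-reduce-< (>-nonZero⁻¹ p)

  toℕ-reduce[1+n]-1 : ∀ {n} → n < p → toℕ (reduce (suc n) -ₚ 1ₚ) ≡ n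
  toℕ-reduce[1+n]-1 {n} n<p = trans (cong toℕ (reduce[1+n]-1≡reduce[n] n)) (toℕ-reduce-< n<p)

  toℕ[l-1] : ∀ {l n} → toℕ l ≡ suc n → toℕ (l -ₚ 1ₚ) ≡ n
  toℕ[l-1] {l} {n} toℕl≡1+n = begin
    toℕ (l -ₚ 1ₚ)                   ≡⟨ cong (λ a → toℕ (a -ₚ 1ₚ)) (trans (sym (reduce-toℕ l)) (cong reduce toℕl≡1+n)) ⟩
    toℕ (reduce (suc n) -ₚ 1ₚ)      ≡⟨ toℕ-reduce[1+n]-1 (ℕ.<-trans (ℕ.n<1+n n) (subst (_< p) toℕl≡1+n (toℕ<n l))) ⟩
    n                               ∎

  toℕ[0-1] : toℕ (0ₚ -ₚ 1ₚ) ≡ pred p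
  toℕ[0-1] = begin
    toℕ (0ₚ -ₚ 1ₚ)                  ≡⟨ cong (λ a → toℕ (a -ₚ 1ₚ)) (trans (sym reduce[p]≡0ₚ) (cong reduce (sym (ℕ.suc-pred p)))) ⟩
    toℕ (reduce (suc (pred p)) -ₚ 1ₚ) ≡⟨ toℕ-reduce[1+n]-1 (subst (pred p <_) (ℕ.suc-pred p) (ℕ.n<1+n (pred p))) ⟩
    pred p                          ∎

  shift-invariant⇒constant : ∀ {A : Set} (f : Fin p → A) → (∀ l → f (l -ₚ 1ₚ) ≡ f l) → ∀ l → f l ≡ f 0ₚ
  shift-invariant⇒constant f f-pred l = trans (cong f (sym (reduce-toℕ l))) (f-reduce (toℕ l))
    where
    f-reduce : ∀ n → f (reduce n) ≡ f 0ₚ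
    f-reduce zero    = refl
    f-reduce (suc n) = trans (sym (f-pred (reduce (suc n)))) (trans (cong f (reduce[1+n]-1≡reduce[n] n)) (f-reduce n))


module GroupRing (p : ℕ) .{{_ : NonZero p}} where

  import Data.Nat.Properties as ℕ
  open import Data.Fin.Base using (toℕ)
  open import Data.Fin.Properties using (_≟_; toℕ-injective)
  open import Data.Integer.Base using (ℤ; +_; -[1+_]; _+_; _*_; -_; _-_)
  import Data.Integer.Properties as ℤ
  open import Data.Integer.Tactic.RingSolver using (solve-∀)
  open import Data.Product.Base using (_,_)
  open import Relation.Nullary using (¬_)
  open import Relation.Nullary.Decidable using (⌊_⌋)
  open import Relation.Nullary.Negation using (contradiction)
  open import Relation.Binary.PropositionalEquality
  open import Algebra.Bundles using (CommutativeRing)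
  open import Algebra.Properties.AbelianGroup ℤ.+-0-abelianGroup using () renaming (⁻¹-anti-homo‿- to neg-[i-j])
  open import Level using (0ℓ)
  open ≡-Reasoning
  open IntegerSums
  open Modular p

  ℤ[Cₚ] : Set
  ℤ[Cₚ] = Fin p → ℤ

  infixl 6 _⊞_
  infixl 7 _⊛_ _·_
  infix  8 ⊟_

  _⊞_ : ℤ[Cₚ] → ℤ[Cₚ] → ℤ[Cₚ]
  (f ⊞ g) i = f i + g i

  ⊟_ : ℤ[Cₚ] → ℤ[Cₚ]
  (⊟ f) i = - f i

  _·_ : ℤ → ℤ[Cₚ] → ℤ[Cₚ]
  (t · f) i = t * f i

  _⊛_ : ℤ[Cₚ] → ℤ[Cₚ] → ℤ[Cₚ]
  (f ⊛ g) l = ∑[ i < p ] (f i * g (l -ₚ i))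

  𝟘 : ℤ[Cₚ]
  𝟘 _ = + 0

  basis : Fin p → ℤ[Cₚ]
  basis a i = δ i a

  𝟙 : ℤ[Cₚ]
  𝟙 = basis 0ₚ

  augmentation : ℤ[Cₚ] → ℤ
  augmentation = sum

  sum-[l-i]≡sum : ∀ l (f : ℤ[Cₚ]) → ∑[ i < p ] f (l -ₚ i) ≡ sum f
  sum-[l-i]≡sum l f = sym (sum-reindex (l -ₚ_) (l -ₚ_) (a-[a-b]≡b l) (a-[a-b]≡b l) f)

  sum-[a+i]≡sum : ∀ a (f : ℤ[Cₚ]) → ∑[ i < p ] f (a +ₚ i) ≡ sum f
  sum-[a+i]≡sum a f = sym (sum-reindex (a +ₚ_) (_-ₚ a) (a+[b-a]≡b a) (a+b-a≡b a) f)

  sum-[i-a]≡sum : ∀ a (f : ℤ[Cₚ]) → ∑[ i < p ] f (i -ₚ a) ≡ sum f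
  sum-[i-a]≡sum a f = sym (sum-reindex (_-ₚ a) (_+ₚ a) (λ i → a+b-b≡a i a) (λ i → a-b+b≡a i a) f)

  ⊛-comm : ∀ f g → f ⊛ g ≗ g ⊛ f
  ⊛-comm f g l = begin
    ∑[ i < p ] (f i * g (l -ₚ i))
      ≡⟨ sum-[l-i]≡sum l (λ i → f i * g (l -ₚ i)) ⟨
    ∑[ i < p ] (f (l -ₚ i) * g (l -ₚ (l -ₚ i)))
      ≡⟨ sum-cong-≗ (λ i → trans (cong (λ j → f (l -ₚ i) * g j) (a-[a-b]≡b l i)) (ℤ.*-comm (f (l -ₚ i)) (g i))) ⟩
    ∑[ i < p ] (g i * f (l -ₚ i))
      ∎

  ⊛-assoc : ∀ f g h → (f ⊛ g) ⊛ h ≗ f ⊛ (g ⊛ h)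
  ⊛-assoc f g h l = begin
    ∑[ m < p ] (∑[ i < p ] (f i * g (m -ₚ i)) * h (l -ₚ m))
      ≡⟨ sum-cong-≗ (λ m → *-distribʳ-sum (h (l -ₚ m)) (λ i → f i * g (m -ₚ i))) ⟩
    ∑[ m < p ] ∑[ i < p ] (f i * g (m -ₚ i) * h (l -ₚ m))
      ≡⟨ ∑-comm (λ m i → f i * g (m -ₚ i) * h (l -ₚ m)) ⟩
    ∑[ i < p ] ∑[ m < p ] (f i * g (m -ₚ i) * h (l -ₚ m))
      ≡⟨ sum-cong-≗ (λ i → sum-[a+i]≡sum i (λ m → f i * g (m -ₚ i) * h (l -ₚ m))) ⟨
    ∑[ i < p ] ∑[ j < p ] (f i * g (i +ₚ j -ₚ i) * h (l -ₚ (i +ₚ j)))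
      ≡⟨ sum-cong-≗ (λ i → sum-cong-≗ (λ j → trans (cong₂ (λ x y → f i * g x * h y) (a+b-a≡b i j) (a-[b+c]≡a-b-c l i j))
                                                  (ℤ.*-assoc (f i) (g j) (h (l -ₚ i -ₚ j))))) ⟩
    ∑[ i < p ] ∑[ j < p ] (f i * (g j * h (l -ₚ i -ₚ j)))
      ≡⟨ sum-cong-≗ (λ i → *-distribˡ-sum (f i) (λ j → g j * h (l -ₚ i -ₚ j))) ⟨
    ∑[ i < p ] (f i * ∑[ j < p ] (g j * h (l -ₚ i -ₚ j)))
      ∎

  basis-⊛ : ∀ a f l → (basis a ⊛ f) l ≡ f (l -ₚ a)
  basis-⊛ a f l = sum-δ a (λ i → f (l -ₚ i))

  basis-⊛-basis : ∀ a b → basis a ⊛ basis b ≗ basis (a +ₚ b)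
  basis-⊛-basis a b l = trans (basis-⊛ a (basis b) l) (δ-cong-⇔ to from)
    where
    to : l -ₚ a ≡ b → l ≡ a +ₚ b
    to l-a≡b = trans (sym (a-b+b≡a l a)) (trans (cong (_+ₚ a) l-a≡b) (+ₚ-comm b a))
    from : l ≡ a +ₚ b → l -ₚ a ≡ b
    from l≡a+b = trans (cong (_-ₚ a) l≡a+b) (a+b-a≡b a b)

  ⊛-identityˡ : ∀ f → 𝟙 ⊛ f ≗ f
  ⊛-identityˡ f l = trans (basis-⊛ 0ₚ f l) (cong f (a-0≡a l))

  ⊛-distribˡ : ∀ f g h → f ⊛ (g ⊞ h) ≗ f ⊛ g ⊞ f ⊛ h
  ⊛-distribˡ f g h l = trans (sum-cong-≗ (λ i → ℤ.*-distribˡ-+ (f i) (g (l -ₚ i)) (h (l -ₚ i))))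
                             (∑-distrib-+ (λ i → f i * g (l -ₚ i)) (λ i → f i * h (l -ₚ i)))

  ·-⊛ : ∀ t f g → t · f ⊛ g ≗ t · (f ⊛ g)
  ·-⊛ t f g l = trans (sum-cong-≗ (λ i → ℤ.*-assoc t (f i) (g (l -ₚ i)))) (sym (*-distribˡ-sum t (λ i → f i * g (l -ₚ i))))

  ⊛-· : ∀ t f g → f ⊛ (t · g) ≗ t · (f ⊛ g)
  ⊛-· t f g l = trans (⊛-comm f (t · g) l) (trans (·-⊛ t g f l) (cong (t *_) (⊛-comm g f l)))

  augmentation-⊛ : ∀ f g → augmentation (f ⊛ g) ≡ augmentation f * augmentation g
  augmentation-⊛ f g = begin
    ∑[ l < p ] ∑[ i < p ] (f i * g (l -ₚ i))  ≡⟨ ∑-comm (λ l i → f i * g (l -ₚ i)) ⟩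
    ∑[ i < p ] ∑[ l < p ] (f i * g (l -ₚ i))  ≡⟨ sum-cong-≗ (λ i → *-distribˡ-sum (f i) (λ l → g (l -ₚ i))) ⟨
    ∑[ i < p ] (f i * ∑[ l < p ] g (l -ₚ i))  ≡⟨ sum-cong-≗ (λ i → cong (f i *_) (sum-[i-a]≡sum i g)) ⟩
    ∑[ i < p ] (f i * sum g)                  ≡⟨ *-distribʳ-sum (sum g) f ⟨
    sum f * sum g                             ∎

  ⊟-⊛ : ∀ f g → ⊟ f ⊛ g ≗ ⊟ (f ⊛ g)
  ⊟-⊛ f g l = trans (sum-cong-≗ (λ i → sym (ℤ.neg-distribˡ-* (f i) (g (l -ₚ i))))) (sum-neg (λ i → f i * g (l -ₚ i)))

  ⊛-distribʳ : ∀ f g h → (g ⊞ h) ⊛ f ≗ g ⊛ f ⊞ h ⊛ f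
  ⊛-distribʳ f g h l = trans (⊛-comm (g ⊞ h) f l) (trans (⊛-distribˡ f g h l) (cong₂ _+_ (⊛-comm f g l) (⊛-comm f h l)))

  ·𝟙-⊛ : ∀ t f → t · 𝟙 ⊛ f ≗ t · f
  ·𝟙-⊛ t f l = trans (·-⊛ t 𝟙 f l) (cong (t *_) (⊛-identityˡ f l))

  expand-⊛ : ∀ a b f g → (f ⊞ ⊟ (a · 𝟙)) ⊛ (g ⊞ ⊟ (b · 𝟙)) ≗ f ⊛ g ⊞ ⊟ (b · f) ⊞ ⊟ (a · g) ⊞ (a * b) · 𝟙
  expand-⊛ a b f g l = begin
    ((f ⊞ ⊟ (a · 𝟙)) ⊛ (g ⊞ ⊟ (b · 𝟙))) l
      ≡⟨ ⊛-distribʳ (g ⊞ ⊟ (b · 𝟙)) f (⊟ (a · 𝟙)) l ⟩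
    (f ⊛ (g ⊞ ⊟ (b · 𝟙))) l + (⊟ (a · 𝟙) ⊛ (g ⊞ ⊟ (b · 𝟙))) l
      ≡⟨ cong₂ _+_ (⊛-distribˡ f g (⊟ (b · 𝟙)) l) (⊟-⊛ (a · 𝟙) (g ⊞ ⊟ (b · 𝟙)) l) ⟩
    (f ⊛ g) l + (f ⊛ ⊟ (b · 𝟙)) l + - (a · 𝟙 ⊛ (g ⊞ ⊟ (b · 𝟙))) l
      ≡⟨ cong₂ (λ x y → (f ⊛ g) l + x + - y) f⊛⊟b (·𝟙-⊛ a (g ⊞ ⊟ (b · 𝟙)) l) ⟩
    (f ⊛ g) l + - (b * f l) + - (a * (g l + - (b * 𝟙 l)))
      ≡⟨ rearrange ((f ⊛ g) l) (f l) (g l) (𝟙 l) a b ⟩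
    (f ⊛ g) l + - (b * f l) + - (a * g l) + a * b * 𝟙 l
      ∎
    where
    rearrange : ∀ c x y e a b → c + - (b * x) + - (a * (y + - (b * e))) ≡ c + - (b * x) + - (a * y) + a * b * e
    rearrange = solve-∀
    f⊛⊟b : (f ⊛ ⊟ (b · 𝟙)) l ≡ - (b * f l)
    f⊛⊟b = trans (⊛-comm f (⊟ (b · 𝟙)) l) (trans (⊟-⊛ (b · 𝟙) f l) (cong -_ (·𝟙-⊛ b f l)))

  infix 4 _≈ζ_

  record _≈ζ_ (f g : ℤ[Cₚ]) : Set where
    constructor differ-by
    field
      offset    : ℤ
      f-g≡offset : ∀ i → f i - g i ≡ offset

  private
    diff-+ : ∀ a b c d → (a + b) - (c + d) ≡ (a - c) + (b - d)
    diff-+ = solve-∀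
    diff-neg : ∀ a b → (- a) - (- b) ≡ - (a - b)
    diff-neg = solve-∀
    diff-* : ∀ a b c → a * c - b * c ≡ (a - b) * c
    diff-* = solve-∀

  ≗⇒≈ζ : ∀ {f g} → f ≗ g → f ≈ζ g
  ≗⇒≈ζ {f} f≗g = differ-by (+ 0) (λ i → trans (cong (_-_ (f i)) (sym (f≗g i))) (ℤ.+-inverseʳ (f i)))

  ≈ζ-sym : ∀ {f g} → f ≈ζ g → g ≈ζ f
  ≈ζ-sym {f} {g} (differ-by c eq) = differ-by (- c) (λ i → trans (sym (neg-[i-j] (f i) (g i))) (cong -_ (eq i)))

  ≈ζ-trans : ∀ {f g h} → f ≈ζ g → g ≈ζ h → f ≈ζ h
  ≈ζ-trans {f} {g} {h} (differ-by c eq) (differ-by d eq′) =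
    differ-by (c + d) (λ i → trans (sym (ℤ.+-minus-telescope (f i) (g i) (h i))) (cong₂ _+_ (eq i) (eq′ i)))

  ⊞-cong : ∀ {f f′ g g′} → f ≈ζ f′ → g ≈ζ g′ → f ⊞ g ≈ζ f′ ⊞ g′
  ⊞-cong {f} {f′} {g} {g′} (differ-by c eq) (differ-by d eq′) =
    differ-by (c + d) (λ i → trans (diff-+ (f i) (g i) (f′ i) (g′ i)) (cong₂ _+_ (eq i) (eq′ i)))

  ⊟-cong : ∀ {f f′} → f ≈ζ f′ → ⊟ f ≈ζ ⊟ f′
  ⊟-cong {f} {f′} (differ-by c eq) = differ-by (- c) (λ i → trans (diff-neg (f i) (f′ i)) (cong -_ (eq i)))

  ·-cong : ∀ t {f g} → f ≈ζ g → t · f ≈ζ t · g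
  ·-cong t {f} {g} (differ-by c eq) = differ-by (t * c) (λ i → trans (factor t (f i) (g i)) (cong (t *_) (eq i)))
    where
    factor : ∀ a x y → a * x - a * y ≡ a * (x - y)
    factor = solve-∀

  ⊛-congʳ : ∀ {f g} h → f ≈ζ g → f ⊛ h ≈ζ g ⊛ h
  ⊛-congʳ {f} {g} h (differ-by c eq) = differ-by (c * augmentation h) λ l → begin
    (f ⊛ h) l - (g ⊛ h) l                      ≡⟨ ∑-distrib-- (λ i → f i * h (l -ₚ i)) (λ i → g i * h (l -ₚ i)) ⟨
    ∑[ i < p ] (f i * h (l -ₚ i) - g i * h (l -ₚ i)) ≡⟨ sum-cong-≗ (λ i → trans (diff-* (f i) (g i) (h (l -ₚ i))) (cong (_* h (l -ₚ i)) (eq i))) ⟩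
    ∑[ i < p ] (c * h (l -ₚ i))                 ≡⟨ *-distribˡ-sum c (λ i → h (l -ₚ i)) ⟨
    c * ∑[ i < p ] h (l -ₚ i)                   ≡⟨ cong (c *_) (sum-[l-i]≡sum l h) ⟩
    c * augmentation h                          ∎

  ⊛-cong : ∀ {f f′ g g′} → f ≈ζ f′ → g ≈ζ g′ → f ⊛ g ≈ζ f′ ⊛ g′
  ⊛-cong {f} {f′} {g} {g′} f≈f′ g≈g′ =
    ≈ζ-trans (⊛-congʳ g f≈f′) (≈ζ-trans (≗⇒≈ζ (⊛-comm f′ g)) (≈ζ-trans (⊛-congʳ f′ g≈g′) (≗⇒≈ζ (⊛-comm g′ f′))))

  ℤ[ζₚ] : CommutativeRing 0ℓ 0ℓ
  ℤ[ζₚ] = record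
    { Carrier = ℤ[Cₚ] ; _≈_ = _≈ζ_ ; _+_ = _⊞_ ; _*_ = _⊛_ ; -_ = ⊟_ ; 0# = 𝟘 ; 1# = 𝟙
    ; isCommutativeRing = record
      { isRing = record
        { +-isAbelianGroup = record
          { isGroup = record
            { isMonoid = record
              { isSemigroup = record
                { isMagma = record
                  { isEquivalence = record { refl = ≗⇒≈ζ (λ _ → refl) ; sym = ≈ζ-sym ; trans = ≈ζ-trans }
                  ; ∙-cong = ⊞-cong }
                ; assoc = λ f g h → ≗⇒≈ζ (λ i → ℤ.+-assoc (f i) (g i) (h i)) }
              ; identity = (λ f → ≗⇒≈ζ (λ i → ℤ.+-identityˡ (f i))) , (λ f → ≗⇒≈ζ (λ i → ℤ.+-identityʳ (f i))) }
            ; inverse = (λ f → ≗⇒≈ζ (λ i → ℤ.+-inverseˡ (f i))) , (λ f → ≗⇒≈ζ (λ i → ℤ.+-inverseʳ (f i)))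
            ; ⁻¹-cong = ⊟-cong }
          ; comm = λ f g → ≗⇒≈ζ (λ i → ℤ.+-comm (f i) (g i)) }
        ; *-cong     = ⊛-cong
        ; *-assoc    = λ f g h → ≗⇒≈ζ (⊛-assoc f g h)
        ; *-identity = (λ f → ≗⇒≈ζ (⊛-identityˡ f)) , (λ f → ≗⇒≈ζ (λ l → trans (⊛-comm f 𝟙 l) (⊛-identityˡ f l)))
        ; distrib    = (λ f g h → ≗⇒≈ζ (⊛-distribˡ f g h)) , (λ f g h → ≗⇒≈ζ (⊛-distribʳ f g h)) }
      ; *-comm = λ f g → ≗⇒≈ζ (⊛-comm f g) } }

  δ≡⟦toℕ≟0⟧ : ∀ i → δ i 0ₚ ≡ ⟦ ⌊ toℕ i ℕ.≟ 0 ⌋ ⟧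
  δ≡⟦toℕ≟0⟧ i = ⟦⌊⌋⟧-cong-⇔ (i ≟ 0ₚ) (toℕ i ℕ.≟ 0)
    (λ i≡0 → trans (cong toℕ i≡0) toℕ-0ₚ) (λ toℕi≡0 → toℕ-injective (trans toℕi≡0 (sym toℕ-0ₚ)))

  ⊞⊟≈𝟘⇒≈ : ∀ {f g} → f ⊞ ⊟ g ≈ζ 𝟘 → f ≈ζ g
  ⊞⊟≈𝟘⇒≈ {f} {g} (differ-by c eq) = differ-by c (λ i → trans (sym (ℤ.+-identityʳ (f i - g i))) (eq i))

  basis⊟𝟙≉𝟘 : ∀ {j} → j ≢ 0ₚ → ¬ (basis j ⊞ ⊟ 𝟙 ≈ζ 𝟘)
  basis⊟𝟙≉𝟘 {j} j≢0 (differ-by c eq) = contradiction (trans at-j (sym at-0)) (λ ())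
    where
    at-j : + 1 ≡ c
    at-j = trans (cong₂ (λ x y → x + - y - + 0) (sym (δ-refl j)) (sym (δ-≢ j≢0))) (eq j)
    at-0 : -[1+ 0 ] ≡ c
    at-0 = trans (cong₂ (λ x y → x + - y - + 0) (sym (δ-≢ (λ 0≡j → j≢0 (sym 0≡j)))) (sym (δ-refl 0ₚ))) (eq 0ₚ)

module DivisibilityByπ (p : ℕ) .{{_ : NonZero p}} where

  open import Data.Nat.Base as ℕ using (zero; suc; pred; _≤_; _<ᵇ_; _≡ᵇ_)
  import Data.Nat.Properties as ℕ
  open import Data.Bool.Base using (true; false; T)
  open import Data.Unit.Base using (tt)
  open import Data.Fin.Base using (toℕ)
  open import Data.Fin.Properties using (toℕ-injective; toℕ<n)
  open import Data.Integer.Base using (ℤ; +_; _+_; _*_; -_; _-_)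
  import Data.Integer.Properties as ℤ
  open import Data.Integer.Divisibility using (_∣_)
  open import Data.Integer.Divisibility.Signed as Signed using (divides; ∣⇒∣ᵤ; ∣ᵤ⇒∣)
  open import Data.Integer.Tactic.RingSolver using (solve-∀)
  open import Data.Product.Base using (∃; _,_)
  open import Relation.Nullary.Negation using (contradiction)
  open import Relation.Binary.PropositionalEquality
  open ≡-Reasoning
  open IntegerSums
  open Modular p
  open GroupRing p

  X π : ℤ[Cₚ]
  X = basis 1ₚ
  π = X ⊞ ⊟ 𝟙

  ≈𝟘⇒p∣augmentation : ∀ {f} → f ≈ζ 𝟘 → + p ∣ augmentation f
  ≈𝟘⇒p∣augmentation {f} (differ-by c eq) = ∣⇒∣ᵤ (divides c (begin
    sum f                 ≡⟨ sum-cong-≗ (λ i → trans (sym (ℤ.+-identityʳ (f i))) (eq i)) ⟩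
    ∑[ i < p ] c          ≡⟨ sum-const p c ⟩
    + p * c               ≡⟨ ℤ.*-comm (+ p) c ⟩
    c * + p               ∎))

  ·-cancel : ∀ {f} → + p · f ≈ζ 𝟘 → f ≈ζ 𝟘
  ·-cancel {f} (differ-by c eq) = differ-by (f 0ₚ) (λ i → trans (ℤ.+-identityʳ (f i)) (ℤ.*-cancelˡ-≡ (+ p) (f i) (f 0ₚ) (trans (pf≡c i) (sym (pf≡c 0ₚ)))))
    where
    pf≡c : ∀ i → + p * f i ≡ c
    pf≡c i = trans (sym (ℤ.+-identityʳ (+ p * f i))) (eq i)

  π-⊛ : ∀ f l → (π ⊛ f) l ≡ f (l -ₚ 1ₚ) - f l
  π-⊛ f l = trans (⊛-distribʳ f X (⊟ 𝟙) l) (cong₂ _+_ (basis-⊛ 1ₚ f l) (trans (⊟-⊛ 𝟙 f l) (cong -_ (⊛-identityˡ f l))))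

  π-cancel : ∀ {f} → π ⊛ f ≈ζ 𝟘 → f ≈ζ 𝟘
  π-cancel {f} (differ-by c eq) = differ-by (f 0ₚ) (λ l → trans (ℤ.+-identityʳ (f l)) (shift-invariant⇒constant f f-pred l))
    where
    step : ∀ l → f (l -ₚ 1ₚ) - f l ≡ c
    step l = trans (sym (trans (ℤ.+-identityʳ ((π ⊛ f) l)) (π-⊛ f l))) (eq l)
    c≡0 : c ≡ + 0
    c≡0 = ℤ.*-cancelˡ-≡ (+ p) c (+ 0) (begin
      + p * c                          ≡⟨ sum-const p c ⟨
      ∑[ l < p ] c                     ≡⟨ sum-cong-≗ step ⟨
      ∑[ l < p ] (f (l -ₚ 1ₚ) - f l)   ≡⟨ ∑-distrib-- (λ l → f (l -ₚ 1ₚ)) f ⟩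
      ∑[ l < p ] f (l -ₚ 1ₚ) - sum f   ≡⟨ cong (_- sum f) (sum-[i-a]≡sum 1ₚ f) ⟩
      sum f - sum f                    ≡⟨ ℤ.+-inverseʳ (sum f) ⟩
      + 0                              ≡⟨ ℤ.*-zeroʳ (+ p) ⟨
      + p * + 0                        ∎)
    f-pred : ∀ l → f (l -ₚ 1ₚ) ≡ f l
    f-pred l = ℤ.i-j≡0⇒i≡j (f (l -ₚ 1ₚ)) (f l) (trans (step l) c≡0)

  geometric : Fin p → ℤ[Cₚ]
  geometric j l = ⟦ toℕ l <ᵇ toℕ j ⟧

  π⊛geometric : ∀ j → π ⊛ geometric j ≗ basis j ⊞ ⊟ 𝟙
  π⊛geometric j l = begin
    (π ⊛ geometric j) l                                      ≡⟨ π-⊛ (geometric j) l ⟩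
    ⟦ toℕ (l -ₚ 1ₚ) <ᵇ toℕ j ⟧ - ⟦ toℕ l <ᵇ toℕ j ⟧          ≡⟨ step (toℕ l) refl ⟩
    ⟦ toℕ l ≡ᵇ toℕ j ⟧ - ⟦ toℕ l ≡ᵇ 0 ⟧                      ≡⟨ cong (λ b → ⟦ toℕ l ≡ᵇ toℕ j ⟧ - ⟦ toℕ l ≡ᵇ b ⟧) (sym toℕ-0ₚ) ⟩
    ⟦ toℕ l ≡ᵇ toℕ j ⟧ - ⟦ toℕ l ≡ᵇ toℕ 0ₚ ⟧                 ≡⟨ cong₂ _-_ (δ-toℕ l j) (δ-toℕ l 0ₚ) ⟨
    δ l j - δ l 0ₚ                                           ∎
    where
    below-difference : ∀ n m → ⟦ n <ᵇ m ⟧ - ⟦ suc n <ᵇ m ⟧ ≡ ⟦ suc n ≡ᵇ m ⟧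
    below-difference zero    zero          = refl
    below-difference zero    (suc zero)    = refl
    below-difference zero    (suc (suc m)) = refl
    below-difference (suc n) zero          = refl
    below-difference (suc n) (suc m)       = below-difference n m
    above-zero : ∀ m → + 0 - ⟦ 0 <ᵇ m ⟧ ≡ ⟦ 0 ≡ᵇ m ⟧ - + 1
    above-zero zero    = refl
    above-zero (suc m) = refl
    above-top : ⟦ pred p <ᵇ toℕ j ⟧ ≡ + 0
    above-top with pred p <ᵇ toℕ j in top<j
    ... | false = refl
    ... | true  = contradiction (subst (_≤ toℕ j) (ℕ.suc-pred p) (ℕ.<ᵇ⇒< (pred p) (toℕ j) (subst T (sym top<j) tt))) (ℕ.<⇒≱ (toℕ<n j))
    step : ∀ n → toℕ l ≡ n → ⟦ toℕ (l -ₚ 1ₚ) <ᵇ toℕ j ⟧ - ⟦ n <ᵇ toℕ j ⟧ ≡ ⟦ n ≡ᵇ toℕ j ⟧ - ⟦ n ≡ᵇ 0 ⟧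
    step zero    toℕl≡0   = begin
      ⟦ toℕ (l -ₚ 1ₚ) <ᵇ toℕ j ⟧ - ⟦ 0 <ᵇ toℕ j ⟧ ≡⟨ cong (λ a → ⟦ a <ᵇ toℕ j ⟧ - ⟦ 0 <ᵇ toℕ j ⟧) toℕ[l-1]≡pred-p ⟩
      ⟦ pred p <ᵇ toℕ j ⟧ - ⟦ 0 <ᵇ toℕ j ⟧         ≡⟨ cong (_- ⟦ 0 <ᵇ toℕ j ⟧) above-top ⟩
      + 0 - ⟦ 0 <ᵇ toℕ j ⟧                         ≡⟨ above-zero (toℕ j) ⟩
      ⟦ 0 ≡ᵇ toℕ j ⟧ - + 1                         ∎
      where
      toℕ[l-1]≡pred-p : toℕ (l -ₚ 1ₚ) ≡ pred p
      toℕ[l-1]≡pred-p = trans (cong (λ a → toℕ (a -ₚ 1ₚ)) (toℕ-injective (trans toℕl≡0 (sym toℕ-0ₚ)))) toℕ[0-1]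
    step (suc n) toℕl≡1+n = begin
      ⟦ toℕ (l -ₚ 1ₚ) <ᵇ toℕ j ⟧ - ⟦ suc n <ᵇ toℕ j ⟧ ≡⟨ cong (λ a → ⟦ a <ᵇ toℕ j ⟧ - ⟦ suc n <ᵇ toℕ j ⟧) (toℕ[l-1] toℕl≡1+n) ⟩
      ⟦ n <ᵇ toℕ j ⟧ - ⟦ suc n <ᵇ toℕ j ⟧           ≡⟨ below-difference n (toℕ j) ⟩
      ⟦ suc n ≡ᵇ toℕ j ⟧                             ≡⟨ ℤ.+-identityʳ ⟦ suc n ≡ᵇ toℕ j ⟧ ⟨
      ⟦ suc n ≡ᵇ toℕ j ⟧ - + 0                       ∎

  π⊛∑geometric : ∀ f → sum f ≡ + 0 → π ⊛ (λ l → ∑[ j < p ] (f j * geometric j l)) ≗ f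
  π⊛∑geometric f Σf≡0 l = begin
    (π ⊛ g) l
      ≡⟨ π-⊛ g l ⟩
    g (l -ₚ 1ₚ) - g l
      ≡⟨ ∑-distrib-- (λ j → f j * geometric j (l -ₚ 1ₚ)) (λ j → f j * geometric j l) ⟨
    ∑[ j < p ] (f j * geometric j (l -ₚ 1ₚ) - f j * geometric j l)
      ≡⟨ sum-cong-≗ (λ j → trans (factor (f j) _ _) (cong (f j *_) (trans (sym (π-⊛ (geometric j) l)) (π⊛geometric j l)))) ⟩
    ∑[ j < p ] (f j * (δ l j - δ l 0ₚ))
      ≡⟨ sum-cong-≗ (λ j → trans (expand (f j) (δ l j) (δ l 0ₚ)) (cong (λ d → d * f j - f j * δ l 0ₚ) (δ-comm l j))) ⟩
    ∑[ j < p ] (δ j l * f j - f j * δ l 0ₚ)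
      ≡⟨ ∑-distrib-- (λ j → δ j l * f j) (λ j → f j * δ l 0ₚ) ⟩
    ∑[ j < p ] (δ j l * f j) - ∑[ j < p ] (f j * δ l 0ₚ)
      ≡⟨ cong₂ _-_ (sum-δ l f) (trans (sym (*-distribʳ-sum (δ l 0ₚ) f)) (cong (_* δ l 0ₚ) Σf≡0)) ⟩
    f l - + 0 * δ l 0ₚ
      ≡⟨ trans (cong (_-_ (f l)) (ℤ.*-zeroˡ (δ l 0ₚ))) (ℤ.+-identityʳ (f l)) ⟩
    f l
      ∎
    where
    g : ℤ[Cₚ]
    g l = ∑[ j < p ] (f j * geometric j l)
    factor : ∀ a x y → a * x - a * y ≡ a * (x - y)
    factor = solve-∀
    expand : ∀ a d e → a * (d - e) ≡ d * a - a * e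
    expand = solve-∀

  p∣augmentation⇒π∣ : ∀ f → + p ∣ augmentation f → ∃ λ g → f ≈ζ π ⊛ g
  p∣augmentation⇒π∣ f p∣Σf = (λ l → ∑[ j < p ] (f₀ j * geometric j l)) ,
    differ-by c (λ l → trans (cong (_-_ (f l)) (π⊛∑geometric f₀ Σf₀≡0 l)) (a-[a-c]≡c (f l) c))
    where
    a-[a-c]≡c : ∀ a c → a - (a - c) ≡ c
    a-[a-c]≡c = solve-∀
    p∣Σf′ : + p Signed.∣ sum f
    p∣Σf′ = ∣ᵤ⇒∣ p∣Σf
    c : ℤ
    c = Signed.quotient p∣Σf′
    f₀ : ℤ[Cₚ]
    f₀ l = f l - c
    Σf₀≡0 : sum f₀ ≡ + 0
    Σf₀≡0 = begin
      sum f₀                 ≡⟨ ∑-distrib-- f (λ _ → c) ⟩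
      sum f - ∑[ i < p ] c   ≡⟨ cong₂ _-_ (Signed._∣_.equality p∣Σf′) (sum-const p c) ⟩
      c * + p - + p * c      ≡⟨ cong (_- + p * c) (ℤ.*-comm c (+ p)) ⟩
      + p * c - + p * c      ≡⟨ ℤ.+-inverseʳ (+ p * c) ⟩
      + 0                    ∎

module BinomialSplit {c ℓ} (R : CommutativeSemiring c ℓ) where

  open import Data.Nat.Base using (zero; suc; _∸_)
  open import Data.Nat.Combinatorics using (_C_; nCn≡1)
  open import Data.Fin.Base using (zero; suc; toℕ; fromℕ; inject₁)
  open import Data.Fin.Properties using (toℕ-fromℕ; toℕ-inject₁)
  open import Function.Base using (_∘_)
  open import Relation.Binary.PropositionalEquality as ≡ using (_≡_; cong)
  open CommutativeSemiring R hiding (zero)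
  open import Algebra.Properties.Semiring.Exp semiring using (_^_)
  open import Algebra.Properties.Semiring.Mult semiring using (_×_; ×-homo-1; ×-congˡ; ×-congʳ)
  open import Algebra.Properties.Semiring.Sum semiring using (sum-init-last; sum-cong-≋; sum-syntax)
  open import Algebra.Properties.CommutativeSemiring.Binomial R using (theorem; binomialTerm)
  open import Relation.Binary.Reasoning.Setoid setoid

  1^n≈1 : ∀ n → 1# ^ n ≈ 1#
  1^n≈1 zero    = refl
  1^n≈1 (suc n) = trans (*-identityˡ (1# ^ n)) (1^n≈1 n)

  [x+1]^[1+m] : ∀ m x → (x + 1#) ^ suc m ≈ 1# + ∑[ k < m ] ((suc m C suc (toℕ k)) × x ^ suc (toℕ k)) + x ^ suc m
  [x+1]^[1+m] m x = begin
    (x + 1#) ^ suc m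
      ≈⟨ theorem (suc m) x 1# ⟩
    term zero + ∑[ k < suc m ] term (suc k)
      ≈⟨ +-congˡ (sum-init-last (term ∘ suc)) ⟩
    term zero + (∑[ k < m ] term (suc (inject₁ k)) + term (suc (fromℕ m)))
      ≈⟨ +-assoc (term zero) _ _ ⟨
    term zero + ∑[ k < m ] term (suc (inject₁ k)) + term (suc (fromℕ m))
      ≈⟨ +-cong (+-cong first (sum-cong-≋ middle)) last ⟩
    1# + ∑[ k < m ] ((suc m C suc (toℕ k)) × x ^ suc (toℕ k)) + x ^ suc m
      ∎
    where
    term : Fin (suc (suc m)) → Carrier
    term = binomialTerm x 1# (suc m)
    term≈ : ∀ k j → toℕ k ≡ j → term k ≈ (suc m C j) × x ^ j
    term≈ k .(toℕ k) ≡.refl = ×-congʳ (suc m C toℕ k) (trans (*-congˡ (1^n≈1 (suc m ∸ toℕ k))) (*-identityʳ (x ^ toℕ k)))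
    first : term zero ≈ 1#
    first = trans (term≈ zero 0 ≡.refl) (×-homo-1 1#)
    middle : ∀ k → term (suc (inject₁ k)) ≈ (suc m C suc (toℕ k)) × x ^ suc (toℕ k)
    middle k = term≈ (suc (inject₁ k)) (suc (toℕ k)) (cong suc (toℕ-inject₁ k))
    last : term (suc (fromℕ m)) ≈ x ^ suc m
    last = trans (term≈ (suc (fromℕ m)) (suc m) (cong suc (toℕ-fromℕ m))) (trans (×-congˡ (nCn≡1 (suc m))) (×-homo-1 (x ^ suc m)))

module PrimeFactorials where

  open import Data.Nat.Base using (zero; suc; _*_; _∸_; _≤_; _<_; _!; nonTrivial⇒≢1)
  import Data.Nat.Properties as ℕ
  open import Data.Nat.Divisibility using (_∣_; m∣m*n; ∣⇒≤; ∣1⇒≡1)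
  open import Data.Nat.DivMod using (_/_; m*[n/m]≡n)
  open import Data.Nat.Combinatorics using (_C_; k![n∸k]!∣n!)
  open import Data.Nat.Combinatorics.Specification using (nCk≡n!/k![n-k]!)
  open import Data.Nat.Primality using (euclidsLemma)
  open import Data.Sum.Base using (inj₁; inj₂)
  open import Relation.Nullary.Negation using (contradiction)
  open import Relation.Binary.PropositionalEquality

  n∣n! : ∀ n .{{_ : NonZero n}} → n ∣ n !
  n∣n! (suc n) = m∣m*n (n !)

  n!≡nCk*k!*[n-k]! : ∀ {n k} → k ≤ n → n ! ≡ (n C k) * (k ! * (n ∸ k) !)
  n!≡nCk*k!*[n-k]! {n} {k} k≤n = begin
    n !                                          ≡⟨ m*[n/m]≡n (k![n∸k]!∣n! k≤n) ⟨
    k ! * (n ∸ k) ! * (n ! / (k ! * (n ∸ k) !))  ≡⟨ cong (k ! * (n ∸ k) ! *_) (nCk≡n!/k![n-k]! k≤n) ⟨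
    k ! * (n ∸ k) ! * (n C k)                    ≡⟨ ℕ.*-comm (k ! * (n ∸ k) !) (n C k) ⟩
    (n C k) * (k ! * (n ∸ k) !)                  ∎
    where
    open ≡-Reasoning
    instance _ = k ℕ.!* (n ∸ k) !≢0

  module _ {p} (p-prime : Prime p) where

    p∣n!⇒p≤n : ∀ n → p ∣ n ! → p ≤ n
    p∣n!⇒p≤n zero    p∣1 = contradiction (∣1⇒≡1 p∣1) (nonTrivial⇒≢1 {{prime⇒nonTrivial p-prime}})
    p∣n!⇒p≤n (suc n) p∣n! with euclidsLemma (suc n) (n !) p-prime p∣n!
    ... | inj₁ p∣1+n = ∣⇒≤ p∣1+n
    ... | inj₂ p∣n!′ = ℕ.m≤n⇒m≤1+n (p∣n!⇒p≤n n p∣n!′)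

    p∣pCk : ∀ {k} → 0 < k → k < p → p ∣ p C k
    p∣pCk {k} 0<k k<p with euclidsLemma (p C k) (k ! * (p ∸ k) !) p-prime p∣pCk*k!*[p-k]!
      where
      p∣pCk*k!*[p-k]! : p ∣ (p C k) * (k ! * (p ∸ k) !)
      p∣pCk*k!*[p-k]! = subst (p ∣_) (n!≡nCk*k!*[n-k]! (ℕ.<⇒≤ k<p)) (n∣n! p {{prime⇒nonZero p-prime}})
    ... | inj₁ p∣pCk = p∣pCk
    ... | inj₂ p∣k!*[p-k]! with euclidsLemma (k !) ((p ∸ k) !) p-prime p∣k!*[p-k]!
    ...   | inj₁ p∣k!     = contradiction (p∣n!⇒p≤n k p∣k!) (ℕ.<⇒≱ k<p)
    ...   | inj₂ p∣[p-k]! = contradiction (p∣n!⇒p≤n (p ∸ k) p∣[p-k]!) (ℕ.<⇒≱ (ℕ.∸-monoʳ-< 0<k (ℕ.<⇒≤ k<p)))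

module Cyclotomic {p : ℕ} (p-prime : Prime p) where

  open import Data.Nat.Base as ℕ using (zero; suc; pred; _<_)
  open import Data.Nat.Induction using (<-wellFounded)
  open import Data.Nat.Primality using (euclidsLemma)
  import Data.Nat.Properties as ℕ
  open import Data.Nat.Combinatorics using (_C_)
  import Data.Nat.Divisibility as ℕ
  open import Data.Fin.Base using (zero; suc; toℕ)
  open import Data.Fin.Properties using (toℕ<n)
  open import Data.Integer.Base using (ℤ; +_; _+_; _*_; -_; _-_; ∣_∣)
  import Data.Integer.Properties as ℤ
  open import Data.Integer.Divisibility using (_∣_)
  open import Data.Integer.Tactic.RingSolver using (solve-∀)
  open import Data.Product.Base using (∃; _,_; proj₁; proj₂)
  open import Data.Sum.Base as Sum using (_⊎_; inj₁; inj₂)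
  open import Relation.Nullary.Negation using (contradiction)
  open import Induction.WellFounded using (Acc; acc)
  open import Function.Base using (_∘_)
  open import Relation.Nullary using (¬_; yes; no)
  open import Relation.Binary.PropositionalEquality as ≡ using (_≡_; _≢_; _≗_)
  open import Algebra.Bundles using (CommutativeRing)
  import Algebra.Properties.Semiring.Sum ℕ.+-*-semiring as ℕΣ

  private instance
    p≢0 : NonZero p
    p≢0 = prime⇒nonZero p-prime

  open Modular p
  open GroupRing p
  open DivisibilityByπ p
  open PrimeFactorials using (p∣pCk)

  module ℤ[ζ] = CommutativeRing ℤ[ζₚ]
  open import Algebra.Properties.Semiring.Exp ℤ[ζ].semiring using (_^_; ^-congˡ; ^-homo-*)
  open import Algebra.Properties.CommutativeSemigroup ℤ[ζ].*-commutativeSemigroup using (interchange)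
  open import Algebra.Properties.Semiring.Mult ℤ[ζ].semiring using (_×_)
  open import Algebra.Properties.Semiring.Sum ℤ[ζ].semiring using () renaming (sum to ∑ζ)
  open BinomialSplit ℤ[ζ].commutativeSemiring using ([x+1]^[1+m])
  open import Relation.Binary.Reasoning.Setoid ℤ[ζ].setoid

  infix 4 _∈pℤ[ζₚ]

  _∈pℤ[ζₚ] : ℤ[Cₚ] → Set
  f ∈pℤ[ζₚ] = ∃ λ w → f ≈ζ + p · w

  ∈pℤ[ζₚ]-resp : ∀ {f g} → f ≈ζ g → g ∈pℤ[ζₚ] → f ∈pℤ[ζₚ]
  ∈pℤ[ζₚ]-resp f≈g (w , g≈pw) = w , ℤ[ζ].trans f≈g g≈pw

  ⊟-∈pℤ[ζₚ] : ∀ {f} → f ∈pℤ[ζₚ] → ⊟ f ∈pℤ[ζₚ]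
  ⊟-∈pℤ[ζₚ] (w , f≈pw) = ⊟ w , ℤ[ζ].trans (⊟-cong f≈pw) (≗⇒≈ζ (λ i → ℤ.neg-distribʳ-* (+ p) (w i)))

  ∑-∈pℤ[ζₚ] : ∀ {n} (t : Fin n → ℤ[Cₚ]) → (∀ k → t k ∈pℤ[ζₚ]) → ∑ζ t ∈pℤ[ζₚ]
  ∑-∈pℤ[ζₚ] {zero}  t _     = 𝟘 , ≗⇒≈ζ (λ i → ≡.sym (ℤ.*-zeroʳ (+ p)))
  ∑-∈pℤ[ζₚ] {suc n} t t∈pℤ with t∈pℤ zero | ∑-∈pℤ[ζₚ] (t ∘ suc) (t∈pℤ ∘ suc)
  ... | (w , t₀≈pw) | (w′ , rest≈pw′) =
    w ⊞ w′ , ℤ[ζ].trans (⊞-cong t₀≈pw rest≈pw′) (≗⇒≈ζ (λ i → ≡.sym (ℤ.*-distribˡ-+ (+ p) (w i) (w′ i))))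

  ×≗· : ∀ n f → n × f ≗ + n · f
  ×≗· zero    f i = ≡.sym (ℤ.*-zeroˡ (f i))
  ×≗· (suc n) f i = ≡.trans (≡.cong (_+_ (f i)) (×≗· n f i)) (≡.sym (ℤ.suc-* (+ n) (f i)))

  ×-∈pℤ[ζₚ] : ∀ {n} → p ℕ.∣ n → ∀ f → n × f ∈pℤ[ζₚ]
  ×-∈pℤ[ζₚ] {n} (ℕ.divides q n≡q*p) f = + q · f , ≗⇒≈ζ (λ i → ≡.trans (×≗· n f i) (n·f≡p·q·f i))
    where
    n·f≡p·q·f : ∀ i → + n * f i ≡ + p * (+ q * f i)
    n·f≡p·q·f i = ≡.trans (≡.cong (λ m → + m * f i) (≡.trans n≡q*p (ℕ.*-comm q p)))
                    (≡.trans (≡.cong (_* f i) (ℤ.pos-* p q)) (ℤ.*-assoc (+ p) (+ q) (f i)))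

  X^n≈basis : ∀ n → X ^ n ≈ζ basis (reduce n)
  X^n≈basis zero    = ℤ[ζ].refl
  X^n≈basis (suc n) = begin
    X ⊛ X ^ n                 ≈⟨ ℤ[ζ].*-congˡ {X} (X^n≈basis n) ⟩
    X ⊛ basis (reduce n)      ≈⟨ ≗⇒≈ζ (basis-⊛-basis 1ₚ (reduce n)) ⟩
    basis (1ₚ +ₚ reduce n)    ≡⟨ ≡.cong basis (reduce-+ 1 n) ⟩
    basis (reduce (suc n))    ∎

  -- (π + 1)^p = X^p = 1, and p divides every binomial coefficient except the two extreme ones.
  π^p∈pℤ[ζₚ] : π ^ p ∈pℤ[ζₚ]
  π^p∈pℤ[ζₚ] = ∈pℤ[ζₚ]-resp π^p≈-M (⊟-∈pℤ[ζₚ] M∈pℤ[ζₚ])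
    where
    m : ℕ
    m = pred p
    1+m≡p : suc m ≡ p
    1+m≡p = ℕ.suc-pred p
    term : Fin m → ℤ[Cₚ]
    term k = (suc m C suc (toℕ k)) × π ^ suc (toℕ k)
    M : ℤ[Cₚ]
    M = ∑ζ term
    M∈pℤ[ζₚ] : M ∈pℤ[ζₚ]
    M∈pℤ[ζₚ] = ∑-∈pℤ[ζₚ] term (λ k → ×-∈pℤ[ζₚ] (p∣C k) (π ^ suc (toℕ k)))
      where
      p∣C : ∀ k → p ℕ.∣ suc m C suc (toℕ k)
      p∣C k = ≡.subst (λ n → p ℕ.∣ n C suc (toℕ k)) (≡.sym 1+m≡p)
                (p∣pCk p-prime ℕ.z<s (≡.subst (suc (toℕ k) <_) 1+m≡p (ℕ.s<s (toℕ<n k))))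
    π+𝟙≈X : π ⊞ 𝟙 ≈ζ X
    π+𝟙≈X = ≗⇒≈ζ (λ i → minus-plus (X i) (𝟙 i))
      where
      minus-plus : ∀ a b → a + - b + b ≡ a
      minus-plus = solve-∀
    expansion : 𝟙 ≈ζ 𝟙 ⊞ M ⊞ π ^ p
    expansion = begin
      𝟙                       ≡⟨ ≡.cong basis reduce[p]≡0ₚ ⟨
      basis (reduce p)        ≈⟨ X^n≈basis p ⟨
      X ^ p                   ≈⟨ ^-congˡ p π+𝟙≈X ⟨
      (π ⊞ 𝟙) ^ p             ≡⟨ ≡.cong ((π ⊞ 𝟙) ^_) 1+m≡p ⟨
      (π ⊞ 𝟙) ^ suc m         ≈⟨ [x+1]^[1+m] m π ⟩
      𝟙 ⊞ M ⊞ π ^ suc m       ≡⟨ ≡.cong (λ n → 𝟙 ⊞ M ⊞ π ^ n) 1+m≡p ⟩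
      𝟙 ⊞ M ⊞ π ^ p           ∎
    π^p≈-M : π ^ p ≈ζ ⊟ M
    π^p≈-M = differ-by (- offset) (λ i → ≡.trans (cancel (𝟙 i) (M i) ((π ^ p) i)) (≡.cong -_ (f-g≡offset i)))
      where
      open _≈ζ_ expansion
      cancel : ∀ a m b → b - - m ≡ - (a - (a + m + b))
      cancel = solve-∀

  record π-Factorization (f : ℤ[Cₚ]) : Set where
    field
      valuation      : ℕ
      cofactor       : ℤ[Cₚ]
      factorization  : f ≈ζ π ^ valuation ⊛ cofactor
      p∤augmentation    : ¬ (+ p ∣ augmentation cofactor)

  π^-cancel : ∀ n {f} → π ^ n ⊛ f ≈ζ 𝟘 → f ≈ζ 𝟘
  π^-cancel zero    {f} πⁿf≈0 = ℤ[ζ].trans (ℤ[ζ].sym (ℤ[ζ].*-identityˡ f)) πⁿf≈0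
  π^-cancel (suc n) {f} πⁿ⁺¹f≈0 = π^-cancel n (π-cancel (ℤ[ζ].trans (ℤ[ζ].sym (ℤ[ζ].*-assoc π (π ^ n) f)) πⁿ⁺¹f≈0))

  π-factorization-or-π^n∣ : ∀ n f → π-Factorization f ⊎ ∃ (λ g → f ≈ζ π ^ n ⊛ g)
  π-factorization-or-π^n∣ zero    f = inj₂ (f , ℤ[ζ].sym (ℤ[ζ].*-identityˡ f))
  π-factorization-or-π^n∣ (suc n) f with π-factorization-or-π^n∣ n f
  ... | inj₁ factorization = inj₁ factorization
  ... | inj₂ (g , f≈πⁿg) with p ℕ.∣? ∣ augmentation g ∣
  ...   | no p∤εg  = inj₁ (record { valuation = n ; cofactor = g ; factorization = f≈πⁿg ; p∤augmentation = p∤εg })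
  ...   | yes p∣εg = inj₂ (h , (begin
    f                   ≈⟨ f≈πⁿg ⟩
    π ^ n ⊛ g           ≈⟨ ℤ[ζ].*-congˡ {π ^ n} g≈πh ⟩
    π ^ n ⊛ (π ⊛ h)     ≈⟨ ℤ[ζ].*-assoc (π ^ n) π h ⟨
    π ^ n ⊛ π ⊛ h       ≈⟨ ℤ[ζ].*-congʳ {h} (ℤ[ζ].*-comm (π ^ n) π) ⟩
    π ^ suc n ⊛ h       ∎))
    where
    h : ℤ[Cₚ]
    h = proj₁ (p∣augmentation⇒π∣ g p∣εg)
    g≈πh : g ≈ζ π ⊛ h
    g≈πh = proj₂ (p∣augmentation⇒π∣ g p∣εg)

  π-factorization-or-∈pℤ[ζₚ] : ∀ f → π-Factorization f ⊎ f ∈pℤ[ζₚ]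
  π-factorization-or-∈pℤ[ζₚ] f with π-factorization-or-π^n∣ p f
  ... | inj₁ factorization = inj₁ factorization
  ... | inj₂ (g , f≈πᵖg) = inj₂ (w ⊛ g , (begin
    f                   ≈⟨ f≈πᵖg ⟩
    π ^ p ⊛ g           ≈⟨ ℤ[ζ].*-congʳ {g} πᵖ≈pw ⟩
    + p · w ⊛ g         ≈⟨ ≗⇒≈ζ (·-⊛ (+ p) w g) ⟩
    + p · (w ⊛ g)       ∎))
    where
    w : ℤ[Cₚ]
    w = proj₁ π^p∈pℤ[ζₚ]
    πᵖ≈pw : π ^ p ≈ζ + p · w
    πᵖ≈pw = proj₂ π^p∈pℤ[ζₚ]

  spread : ℤ[Cₚ] → ℕ
  spread f = ℕΣ.sum (λ i → ∣ f i - f 0ₚ ∣)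

  spread-cong : ∀ {f g} → f ≈ζ g → spread f ≡ spread g
  spread-cong {f} {g} (differ-by c eq) = ℕΣ.sum-cong-≗ (λ i → ≡.cong ∣_∣ (≡.trans (shuffle (f i) (f 0ₚ) (g i) (g 0ₚ))
    (≡.trans (≡.cong (λ d → g i - g 0ₚ + d) (≡.trans (≡.cong₂ _-_ (eq i) (eq 0ₚ)) (ℤ.+-inverseʳ c))) (ℤ.+-identityʳ (g i - g 0ₚ)))))
    where
    shuffle : ∀ a b a′ b′ → a - b ≡ a′ - b′ + ((a - a′) - (b - b′))
    shuffle = solve-∀

  spread-· : ∀ f → spread (+ p · f) ≡ p ℕ.* spread f
  spread-· f = ≡.trans (ℕΣ.sum-cong-≗ (λ i → ≡.trans (≡.cong ∣_∣ (factor (+ p) (f i) (f 0ₚ))) (ℤ.abs-* (+ p) (f i - f 0ₚ))))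
                       (≡.sym (ℕΣ.*-distribˡ-sum p (λ i → ∣ f i - f 0ₚ ∣)))
    where
    factor : ∀ a x y → a * x - a * y ≡ a * (x - y)
    factor = solve-∀

  spread≡0⇒≈𝟘 : ∀ {f} → spread f ≡ 0 → f ≈ζ 𝟘
  spread≡0⇒≈𝟘 {f} spread≡0 = differ-by (f 0ₚ) (λ i → ≡.trans (ℤ.+-identityʳ (f i))
    (ℤ.i-j≡0⇒i≡j (f i) (f 0ₚ) (ℤ.∣i∣≡0⇒i≡0 (summands≡0 (λ i → ∣ f i - f 0ₚ ∣) spread≡0 i))))
    where
    summands≡0 : ∀ {n} (t : Fin n → ℕ) → ℕΣ.sum t ≡ 0 → ∀ i → t i ≡ 0
    summands≡0 t Σt≡0 zero    = ℕ.m+n≡0⇒m≡0 (t zero) Σt≡0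
    summands≡0 t Σt≡0 (suc i) = summands≡0 (t ∘ suc) (ℕ.m+n≡0⇒n≡0 (t zero) Σt≡0) i

  spread-decreases : ∀ {f h} → f ≈ζ + p · h → spread f ≢ 0 → spread h < spread f
  spread-decreases {f} {h} f≈ph spread-f≢0 =
    ≡.subst (spread h <_) (≡.trans (ℕ.*-comm (spread h) p) (≡.sym spread-f≡p*spread-h)) (ℕ.m<m*n (spread h) p {{spread-h≢0}} 1<p)
    where
    spread-f≡p*spread-h : spread f ≡ p ℕ.* spread h
    spread-f≡p*spread-h = ≡.trans (spread-cong f≈ph) (spread-· h)
    spread-h≢0 : NonZero (spread h)
    spread-h≢0 = ℕ.≢-nonZero (λ spread-h≡0 → spread-f≢0 (≡.trans spread-f≡p*spread-h (≡.trans (≡.cong (p ℕ.*_) spread-h≡0) (ℕ.*-zeroʳ p))))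
    1<p : 1 < p
    1<p = ℕ.nonTrivial⇒n>1 p {{prime⇒nonTrivial p-prime}}

  π-factorization-⊛≉𝟘 : ∀ {f g} → π-Factorization f → π-Factorization g → ¬ (f ⊛ g ≈ζ 𝟘)
  π-factorization-⊛≉𝟘 {f} {g} πᵛf πᵛg fg≈0 =
    Sum.[ p∤augmentation πᵛf , p∤augmentation πᵛg ]′ (euclidsLemma ∣ augmentation u ∣ ∣ augmentation w ∣ p-prime p∣augmentation-product)
    where
    open π-Factorization
    i j : ℕ
    i = valuation πᵛf
    j = valuation πᵛg
    u w : ℤ[Cₚ]
    u = cofactor πᵛf
    w = cofactor πᵛg
    uw≈0 : u ⊛ w ≈ζ 𝟘
    uw≈0 = π^-cancel (i ℕ.+ j) (begin
      π ^ (i ℕ.+ j) ⊛ (u ⊛ w)        ≈⟨ ℤ[ζ].*-congʳ {u ⊛ w} (^-homo-* π i j) ⟩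
      π ^ i ⊛ π ^ j ⊛ (u ⊛ w)        ≈⟨ interchange (π ^ i) (π ^ j) u w ⟩
      (π ^ i ⊛ u) ⊛ (π ^ j ⊛ w)      ≈⟨ ℤ[ζ].*-cong (factorization πᵛf) (factorization πᵛg) ⟨
      f ⊛ g                          ≈⟨ fg≈0 ⟩
      𝟘                              ∎)
    p∣augmentation-product : p ℕ.∣ ∣ augmentation u ∣ ℕ.* ∣ augmentation w ∣
    p∣augmentation-product = ≡.subst (p ℕ.∣_) (≡.trans (≡.cong ∣_∣ (augmentation-⊛ u w)) (ℤ.abs-* (augmentation u) (augmentation w))) (≈𝟘⇒p∣augmentation uw≈0)

  domain : ∀ f g → f ⊛ g ≈ζ 𝟘 → f ≈ζ 𝟘 ⊎ g ≈ζ 𝟘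
  domain f g = descent f g (<-wellFounded (spread f ℕ.+ spread g))
    where
    p·𝟘≈𝟘 : ∀ {h} → h ≈ζ 𝟘 → + p · h ≈ζ 𝟘
    p·𝟘≈𝟘 h≈0 = ℤ[ζ].trans (·-cong (+ p) h≈0) (≗⇒≈ζ (λ _ → ℤ.*-zeroʳ (+ p)))
    descent : ∀ f g → Acc _<_ (spread f ℕ.+ spread g) → f ⊛ g ≈ζ 𝟘 → f ≈ζ 𝟘 ⊎ g ≈ζ 𝟘
    descent f g (acc smaller) fg≈0
      with spread f ℕ.≟ 0 | spread g ℕ.≟ 0 | π-factorization-or-∈pℤ[ζₚ] f | π-factorization-or-∈pℤ[ζₚ] g
    ... | yes spread-f≡0 | _ | _ | _ = inj₁ (spread≡0⇒≈𝟘 spread-f≡0)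
    ... | _ | yes spread-g≡0 | _ | _ = inj₂ (spread≡0⇒≈𝟘 spread-g≡0)
    ... | no spread-f≢0 | _ | inj₂ (h , f≈ph) | _ =
      Sum.map₁ (λ h≈0 → ℤ[ζ].trans f≈ph (p·𝟘≈𝟘 h≈0))
        (descent h g (smaller (ℕ.+-monoˡ-< (spread g) (spread-decreases f≈ph spread-f≢0)))
          (·-cancel (ℤ[ζ].trans (ℤ[ζ].sym (≗⇒≈ζ (·-⊛ (+ p) h g))) (ℤ[ζ].trans (ℤ[ζ].*-congʳ {g} (ℤ[ζ].sym f≈ph)) fg≈0))))
    ... | _ | no spread-g≢0 | _ | inj₂ (h , g≈ph) =
      Sum.map₂ (λ h≈0 → ℤ[ζ].trans g≈ph (p·𝟘≈𝟘 h≈0))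
        (descent f h (smaller (ℕ.+-monoʳ-< (spread f) (spread-decreases g≈ph spread-g≢0)))
          (·-cancel (ℤ[ζ].trans (ℤ[ζ].sym (≗⇒≈ζ (⊛-· (+ p) f h))) (ℤ[ζ].trans (ℤ[ζ].*-congˡ {f} (ℤ[ζ].sym g≈ph)) fg≈0))))
    ... | _ | _ | inj₁ πᵛf | inj₁ πᵛg = contradiction fg≈0 (π-factorization-⊛≉𝟘 πᵛf πᵛg)

module IntegerQuadratic where

  open import Data.Nat.Base as ℕ using (zero; suc)
  import Data.Nat.Properties as ℕ
  open import Data.Integer.Base using (ℤ; +_; _+_; _*_; -_; _-_; ∣_∣)
  import Data.Integer.Properties as ℤ
  open import Data.Integer.DivMod using (_%ℕ_; _/ℕ_; n%ℕd<d; a≡a%ℕn+[a/ℕn]*n)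
  open import Data.Integer.Tactic.RingSolver using (solve-∀)
  open import Data.Product.Base using (∃; _,_)
  open import Algebra.Bundles using (AbelianGroup)
  open import Algebra.Properties.Group (AbelianGroup.group ℤ.+-0-abelianGroup) using (∙-cancelˡ)
  open import Relation.Nullary.Negation using (contradiction)
  open import Relation.Binary.PropositionalEquality

  1+2w≢0 : ∀ w → + 1 + + 2 * w ≢ + 0
  1+2w≢0 w 1+2w≡0 = contradiction (ℕ.m*n≡1⇒m≡1 2 ∣ - w ∣ (trans (sym (ℤ.abs-* (+ 2) (- w))) (cong ∣_∣ (sym 1≡2*[-w])))) (λ ())
    where
    flip-sign : ∀ w → + 1 - + 2 * - w ≡ + 1 + + 2 * w
    flip-sign = solve-∀
    1≡2*[-w] : + 1 ≡ + 2 * - w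
    1≡2*[-w] = ℤ.i-j≡0⇒i≡j (+ 1) (+ 2 * - w) (trans (flip-sign w) 1+2w≡0)

  -- s² ≡ e² (mod 4) forces s − e to be even, and r = (s − e)/2.
  square-discriminant⇒root : ∀ s e K → s * s ≡ e * e + + 4 * K → ∃ λ r → e * r + r * r ≡ K
  square-discriminant⇒root s e K s²≡Δ with (s - e) %ℕ 2 | n%ℕd<d (s - e) 2 | a≡a%ℕn+[a/ℕn]*n (s - e) 2
  ... | zero | _ | s-e≡2r = r , ℤ.*-cancelˡ-≡ (+ 4) (e * r + r * r) K (∙-cancelˡ (e * e) _ _ (begin
    e * e + + 4 * (e * r + r * r)       ≡⟨ even e r ⟨
    (e + (+ 0 + r * + 2)) * (e + (+ 0 + r * + 2)) ≡⟨ cong (λ d → (e + d) * (e + d)) s-e≡2r ⟨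
    (e + (s - e)) * (e + (s - e))       ≡⟨ cong (λ x → x * x) (add-sub e s) ⟩
    s * s                               ≡⟨ s²≡Δ ⟩
    e * e + + 4 * K                     ∎))
    where
    open ≡-Reasoning
    r : ℤ
    r = (s - e) /ℕ 2
    even : ∀ e r → (e + (+ 0 + r * + 2)) * (e + (+ 0 + r * + 2)) ≡ e * e + + 4 * (e * r + r * r)
    even = solve-∀
    add-sub : ∀ e s → e + (s - e) ≡ s
    add-sub = solve-∀
  ... | suc zero | _ | s-e≡1+2r = contradiction s²-Δ≡1+2w (1+2w≢0 w)
    where
    r w : ℤ
    r = (s - e) /ℕ 2
    w = e + + 2 * e * r + + 2 * r + + 2 * r * r - + 2 * K
    odd : ∀ e r K → (e + (+ 1 + r * + 2)) * (e + (+ 1 + r * + 2)) - (e * e + + 4 * K) ≡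
                    + 1 + + 2 * (e + + 2 * e * r + + 2 * r + + 2 * r * r - + 2 * K)
    odd = solve-∀
    add-sub : ∀ e s → e + (s - e) ≡ s
    add-sub = solve-∀
    s≡e+1+2r : s ≡ e + (+ 1 + r * + 2)
    s≡e+1+2r = trans (sym (add-sub e s)) (cong (_+_ e) s-e≡1+2r)
    s²-Δ≡1+2w : + 1 + + 2 * w ≡ + 0
    s²-Δ≡1+2w = trans (sym (odd e r K)) (trans (cong (λ x → x * x - (e * e + + 4 * K)) (sym s≡e+1+2r)) (ℤ.i≡j⇒i-j≡0 s²≡Δ))
  ... | suc (suc _) | ℕ.s≤s (ℕ.s≤s ()) | _

module DifferenceCounts {v : ℕ} (G : FiniteGroup v) where

  open import Data.Bool.Base using (Bool; true; false; _∧_)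
  open import Data.Fin.Properties using (_≟_)
  open import Data.Integer.Base using (ℤ; +_; _+_; _*_; _-_)
  import Data.Integer.Properties as ℤ
  open import Data.Integer.Tactic.RingSolver using (solve-∀)
  open import Algebra.Bundles using (Group)
  open import Relation.Nullary.Decidable using (⌊_⌋; yes; no)
  open import Relation.Binary.PropositionalEquality
  open ≡-Reasoning
  open IntegerSums
  open FiniteGroup G renaming (_·_ to _∙_)

  private
    Gᵍ : Group _ _
    Gᵍ = record { isGroup = isGroup }
    open import Algebra.Properties.Group Gᵍ using (x∙y⁻¹≈ε⇒x≈y; x≈y⇒x∙y⁻¹≈ε)

  reps-sum : ∀ (D : Fin v → Bool) g → + reps G D g ≡ ∑[ x < v ] ∑[ y < v ] (⟦ D x ⟧ * ⟦ D y ⟧ * δ (x ∙ y ⁻¹) g)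
  reps-sum D g = trans (card₂-sum (λ x y → D x ∧ D y ∧ ⌊ x ∙ y ⁻¹ ≟ g ⌋))
    (sum-cong-≗ (λ x → sum-cong-≗ (λ y → trans (⟦a∧b⟧≡⟦a⟧*⟦b⟧ (D x) (D y ∧ ⌊ x ∙ y ⁻¹ ≟ g ⌋))
      (trans (cong (⟦ D x ⟧ *_) (⟦a∧b⟧≡⟦a⟧*⟦b⟧ (D y) ⌊ x ∙ y ⁻¹ ≟ g ⌋)) (sym (ℤ.*-assoc ⟦ D x ⟧ ⟦ D y ⟧ (δ (x ∙ y ⁻¹) g)))))))

  reps-ε : ∀ (D : Fin v → Bool) → + reps G D ε ≡ + card D
  reps-ε D = begin
    + reps G D ε
      ≡⟨ reps-sum D ε ⟩
    ∑[ x < v ] ∑[ y < v ] (⟦ D x ⟧ * ⟦ D y ⟧ * δ (x ∙ y ⁻¹) ε)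
      ≡⟨ sum-cong-≗ (λ x → sum-cong-≗ (λ y → trans (cong (⟦ D x ⟧ * ⟦ D y ⟧ *_) (δ[x∙y⁻¹,ε]≡δ[y,x] x y))
                                                 (rearrange ⟦ D x ⟧ ⟦ D y ⟧ (δ y x)))) ⟩
    ∑[ x < v ] ∑[ y < v ] (δ y x * (⟦ D x ⟧ * ⟦ D y ⟧))
      ≡⟨ sum-cong-≗ (λ x → trans (sum-δ x (λ y → ⟦ D x ⟧ * ⟦ D y ⟧)) (⟦b⟧*⟦b⟧≡⟦b⟧ (D x))) ⟩
    ∑[ x < v ] ⟦ D x ⟧
      ≡⟨ card-sum D ⟨
    + card D
      ∎
    where
    rearrange : ∀ a b d → a * b * d ≡ d * (a * b)
    rearrange = solve-∀
    δ[x∙y⁻¹,ε]≡δ[y,x] : ∀ x y → δ (x ∙ y ⁻¹) ε ≡ δ y x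
    δ[x∙y⁻¹,ε]≡δ[y,x] x y = δ-cong-⇔ (λ eq → sym (x∙y⁻¹≈ε⇒x≈y x y eq)) (λ eq → x≈y⇒x∙y⁻¹≈ε (sym eq))

  reps-pds : ∀ {D k lam mu} → IsPDS G D k lam mu → IsRegular G D → ∀ g →
             + reps G D g ≡ + mu + (+ k - + mu) * δ g ε + (+ lam - + mu) * ⟦ D g ⟧
  reps-pds {D} {k} {lam} {mu} pds reg g with g ≟ ε
  ... | yes refl = trans (reps-ε D) (trans (cong +_ (IsPDS.size pds)) (sym (trans
          (cong (λ b → + mu + (+ k - + mu) * + 1 + (+ lam - + mu) * ⟦ b ⟧) (IsRegular.noUnit reg))
          (at-ε (+ k) (+ mu) (+ lam)))))
    where
    at-ε : ∀ k m l → m + (k - m) * + 1 + (l - m) * + 0 ≡ k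
    at-ε = solve-∀
  ... | no g≢ε with D g in Dg
  ...   | true  = trans (cong +_ (IsPDS.inD pds g g≢ε Dg)) (sym (in-D (+ k) (+ mu) (+ lam)))
    where
    in-D : ∀ k m l → m + (k - m) * + 0 + (l - m) * + 1 ≡ l
    in-D = solve-∀
  ...   | false = trans (cong +_ (IsPDS.outD pds g g≢ε Dg)) (sym (out-D (+ k) (+ mu) (+ lam)))
    where
    out-D : ∀ k m l → m + (k - m) * + 0 + (l - m) * + 0 ≡ m
    out-D = solve-∀

module Pushforward {v : ℕ} (G : FiniteGroup v) {p : ℕ} .{{_ : NonZero p}}
                   (φ : Fin v → Fin p) (φ-hom : IsHomToZp G p φ) where

  import Data.Nat.Base as ℕ
  open import Data.Bool.Base using (Bool; _∧_)
  open import Data.Fin.Base using (toℕ)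
  open import Data.Fin.Properties using (toℕ-injective)
  open import Data.Integer.Base using (ℤ; +_; _+_; _*_; -_; _-_)
  import Data.Integer.Properties as ℤ
  open import Data.Integer.Tactic.RingSolver using (solve-∀)
  open import Algebra.Bundles using (Group; AbelianGroup)
  open import Relation.Binary.PropositionalEquality
  open ≡-Reasoning
  open IntegerSums
  open Modular p
  open GroupRing p
  open DifferenceCounts G using (reps-sum)
  open FiniteGroup G renaming (_·_ to _∙_)

  private
    Gᵍ : Group _ _
    Gᵍ = record { isGroup = isGroup }
    module Gᵍ = Group Gᵍ
    open import Algebra.Properties.Group Gᵍ using (⁻¹-involutive; //-rightDividesˡ; //-rightDividesʳ)
    open import Algebra.Properties.Group (AbelianGroup.group ℤ/p) using (identityʳ-unique; inverseʳ-unique)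

  φ-∙ : ∀ x y → φ (x ∙ y) ≡ φ x +ₚ φ y
  φ-∙ x y = toℕ-injective (trans (φ-hom x y) (sym (toℕ-reduce (toℕ (φ x) ℕ.+ toℕ (φ y)))))

  φ-ε : φ ε ≡ 0ₚ
  φ-ε = identityʳ-unique (φ ε) (φ ε) (trans (sym (φ-∙ ε ε)) (cong φ (Gᵍ.identityˡ ε)))

  φ-⁻¹ : ∀ x → φ (x ⁻¹) ≡ negₚ (φ x)
  φ-⁻¹ x = inverseʳ-unique (φ x) (φ (x ⁻¹)) (trans (sym (φ-∙ x (x ⁻¹))) (trans (cong φ (Gᵍ.inverseʳ x)) φ-ε))

  φ-∙⁻¹ : ∀ x y → φ (x ∙ y ⁻¹) ≡ φ x -ₚ φ y
  φ-∙⁻¹ x y = trans (φ-∙ x (y ⁻¹)) (cong (φ x +ₚ_) (φ-⁻¹ y))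

  push : (Fin v → ℤ) → ℤ[Cₚ]
  push w l = ∑[ g < v ] (w g * δ (φ g) l)

  push-+ : ∀ (u w : Fin v → ℤ) → push (λ g → u g + w g) ≗ push u ⊞ push w
  push-+ u w l = trans (sum-cong-≗ (λ g → ℤ.*-distribʳ-+ (δ (φ g) l) (u g) (w g)))
                       (∑-distrib-+ (λ g → u g * δ (φ g) l) (λ g → w g * δ (φ g) l))

  push-* : ∀ a (w : Fin v → ℤ) → push (λ g → a * w g) ≗ a · push w
  push-* a w l = trans (sum-cong-≗ (λ g → ℤ.*-assoc a (w g) (δ (φ g) l))) (sym (*-distribˡ-sum a (λ g → w g * δ (φ g) l)))

  push-δ : ∀ a → push (λ g → δ g a) ≗ basis (φ a)
  push-δ a l = trans (sum-δ a (λ g → δ (φ g) l)) (δ-comm (φ a) l)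

  push-⊛ : ∀ (u w : Fin v → ℤ) l → (push u ⊛ push (λ g → w (g ⁻¹))) l ≡ ∑[ x < v ] ∑[ y < v ] (u x * w y * δ (φ (x ∙ y ⁻¹)) l)
  push-⊛ u w l = begin
    ∑[ i < p ] (∑[ x < v ] (u x * δ (φ x) i) * w⁻ (l -ₚ i))
      ≡⟨ sum-cong-≗ (λ i → *-distribʳ-sum (w⁻ (l -ₚ i)) (λ x → u x * δ (φ x) i)) ⟩
    ∑[ i < p ] ∑[ x < v ] (u x * δ (φ x) i * w⁻ (l -ₚ i))
      ≡⟨ ∑-comm (λ i x → u x * δ (φ x) i * w⁻ (l -ₚ i)) ⟩
    ∑[ x < v ] ∑[ i < p ] (u x * δ (φ x) i * w⁻ (l -ₚ i))
      ≡⟨ sum-cong-≗ (λ x → sum-cong-≗ (λ i → trans (rearrange (u x) (δ (φ x) i) (w⁻ (l -ₚ i))) (cong (_* (u x * w⁻ (l -ₚ i))) (δ-comm (φ x) i)))) ⟩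
    ∑[ x < v ] ∑[ i < p ] (δ i (φ x) * (u x * w⁻ (l -ₚ i)))
      ≡⟨ sum-cong-≗ (λ x → sum-δ (φ x) (λ i → u x * w⁻ (l -ₚ i))) ⟩
    ∑[ x < v ] (u x * w⁻ (l -ₚ φ x))
      ≡⟨ sum-cong-≗ (λ x → *-distribˡ-sum (u x) (λ y → w (y ⁻¹) * δ (φ y) (l -ₚ φ x))) ⟩
    ∑[ x < v ] ∑[ y < v ] (u x * (w (y ⁻¹) * δ (φ y) (l -ₚ φ x)))
      ≡⟨ sum-cong-≗ (λ x → sum-reindex _⁻¹ _⁻¹ ⁻¹-involutive ⁻¹-involutive (λ y → u x * (w (y ⁻¹) * δ (φ y) (l -ₚ φ x)))) ⟩
    ∑[ x < v ] ∑[ y < v ] (u x * (w (y ⁻¹ ⁻¹) * δ (φ (y ⁻¹)) (l -ₚ φ x)))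
      ≡⟨ sum-cong-≗ (λ x → sum-cong-≗ (λ y → trans (cong₂ (λ z d → u x * (w z * d)) (⁻¹-involutive y) (δ-cong-⇔ (to x y) (from x y)))
                                                  (sym (ℤ.*-assoc (u x) (w y) (δ (φ (x ∙ y ⁻¹)) l))))) ⟩
    ∑[ x < v ] ∑[ y < v ] (u x * w y * δ (φ (x ∙ y ⁻¹)) l)
      ∎
    where
    w⁻ : ℤ[Cₚ]
    w⁻ = push (λ g → w (g ⁻¹))
    rearrange : ∀ a d b → a * d * b ≡ d * (a * b)
    rearrange = solve-∀
    to : ∀ x y → φ (y ⁻¹) ≡ l -ₚ φ x → φ (x ∙ y ⁻¹) ≡ l
    to x y eq = trans (φ-∙ x (y ⁻¹)) (trans (cong (φ x +ₚ_) eq) (a+[b-a]≡b (φ x) l))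
    from : ∀ x y → φ (x ∙ y ⁻¹) ≡ l → φ (y ⁻¹) ≡ l -ₚ φ x
    from x y eq = trans (sym (a+b-a≡b (φ x) (φ (y ⁻¹)))) (cong (_-ₚ φ x) (trans (sym (φ-∙ x (y ⁻¹))) eq))

  push-reps : ∀ (D : Fin v → Bool) → push (λ g → + reps G D g) ≗ push (λ g → ⟦ D g ⟧) ⊛ push (λ g → ⟦ D (g ⁻¹) ⟧)
  push-reps D l = begin
    ∑[ g < v ] (+ reps G D g * δ (φ g) l)
      ≡⟨ sum-cong-≗ (λ g → cong (_* δ (φ g) l) (reps-sum D g)) ⟩
    ∑[ g < v ] (∑[ x < v ] ∑[ y < v ] (⟦ D x ⟧ * ⟦ D y ⟧ * δ (x ∙ y ⁻¹) g) * δ (φ g) l)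
      ≡⟨ sum-collapse₂ (λ x y → ⟦ D x ⟧ * ⟦ D y ⟧) (λ x y → x ∙ y ⁻¹) (λ g → δ (φ g) l) ⟩
    ∑[ x < v ] ∑[ y < v ] (⟦ D x ⟧ * ⟦ D y ⟧ * δ (φ (x ∙ y ⁻¹)) l)
      ≡⟨ push-⊛ (λ g → ⟦ D g ⟧) (λ g → ⟦ D g ⟧) l ⟨
    (push (λ g → ⟦ D g ⟧) ⊛ push (λ g → ⟦ D (g ⁻¹) ⟧)) l
      ∎

  fibres : ℤ[Cₚ]
  fibres = push (λ _ → + 1)

  basis-⊛-fibres : ∀ a → basis (φ a) ⊛ fibres ≗ fibres
  basis-⊛-fibres a l = begin
    (basis (φ a) ⊛ fibres) l                   ≡⟨ basis-⊛ (φ a) fibres l ⟩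
    ∑[ g < v ] (+ 1 * δ (φ g) (l -ₚ φ a))
      ≡⟨ sum-reindex (_∙ a ⁻¹) (_∙ a) (//-rightDividesʳ a) (//-rightDividesˡ a) (λ g → + 1 * δ (φ g) (l -ₚ φ a)) ⟩
    ∑[ g < v ] (+ 1 * δ (φ (g ∙ a ⁻¹)) (l -ₚ φ a))
      ≡⟨ sum-cong-≗ (λ g → cong (+ 1 *_) (δ-cong-⇔ (to g) (from g))) ⟩
    ∑[ g < v ] (+ 1 * δ (φ g) l)
      ∎
    where
    to : ∀ g → φ (g ∙ a ⁻¹) ≡ l -ₚ φ a → φ g ≡ l
    to g eq = trans (sym (a-b+b≡a (φ g) (φ a))) (trans (cong (_+ₚ φ a) (trans (sym (φ-∙⁻¹ g a)) eq)) (a-b+b≡a l (φ a)))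
    from : ∀ g → φ g ≡ l → φ (g ∙ a ⁻¹) ≡ l -ₚ φ a
    from g eq = trans (φ-∙⁻¹ g a) (cong (_-ₚ φ a) eq)

  card-fibre : ∀ (D P : Fin v → Bool) j → (∀ g → ⟦ P g ⟧ ≡ δ (φ g) j) → + card (λ g → P g ∧ D g) ≡ push (λ g → ⟦ D g ⟧) j
  card-fibre D P j ⟦P⟧≡δ = trans (card-sum (λ g → P g ∧ D g))
    (sum-cong-≗ (λ g → trans (⟦a∧b⟧≡⟦a⟧*⟦b⟧ (P g) (D g)) (trans (cong (_* ⟦ D g ⟧) (⟦P⟧≡δ g)) (ℤ.*-comm (δ (φ g) j) ⟦ D g ⟧))))

  augmentation-push : ∀ (w : Fin v → ℤ) → augmentation (push w) ≡ sum w
  augmentation-push w = begin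
    ∑[ l < p ] ∑[ g < v ] (w g * δ (φ g) l)   ≡⟨ ∑-comm (λ l g → w g * δ (φ g) l) ⟩
    ∑[ g < v ] ∑[ l < p ] (w g * δ (φ g) l)   ≡⟨ sum-cong-≗ (λ g → trans (sum-cong-≗ (λ l → swap g l)) (sum-δ (φ g) (λ _ → w g))) ⟩
    sum w                                     ∎
    where
    swap : ∀ g l → w g * δ (φ g) l ≡ δ l (φ g) * w g
    swap g l = trans (ℤ.*-comm (w g) (δ (φ g) l)) (cong (_* w g) (δ-comm (φ g) l))

module CharacterValues {v : ℕ} (G : FiniteGroup v) {p : ℕ} (p-prime : Prime p)
                       (φ : Fin v → Fin p) (φ-hom : IsHomToZp G p {{prime⇒nonZero p-prime}} φ) where

  import Data.Nat.Properties as ℕ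
  open import Data.Bool.Base using (Bool; true; false; if_then_else_; _∧_)
  open import Data.Fin.Base using (toℕ)
  open import Data.Fin.Properties using (_≟_)
  open import Relation.Nullary.Decidable using (⌊_⌋)
  open import Algebra.Bundles using (AbelianGroup)
  open import Data.Integer.Base using (ℤ; +_; _+_; _*_; -_; _-_)
  import Data.Integer.Properties as ℤ
  open import Data.Integer.Divisibility using (_∣_)
  open import Data.Integer.Divisibility.Signed using (divides; ∣⇒∣ᵤ)
  open import Data.Integer.Tactic.RingSolver using (solve-∀)
  open import Data.Product.Base using (∃; _,_; proj₁; proj₂)
  import Data.Sum.Base as Sum
  open import Relation.Nullary.Negation using (contradiction)
  open import Relation.Binary.PropositionalEquality
  open IntegerSums
  open IntegerQuadratic using (square-discriminant⇒root)

  private instance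
    p≢0 : NonZero p
    p≢0 = prime⇒nonZero p-prime

  open Modular p
  open GroupRing p
  open Cyclotomic p-prime using (domain)
  open FiniteGroup G renaming (_·_ to _∙_)
  open import Algebra.Properties.Group (AbelianGroup.group ℤ/p) using (x∙y⁻¹≈ε⇒x≈y; x≈y⇒x∙y⁻¹≈ε)

  private
    a-b≡c⇒a≡c+b : ∀ a b c → a - b ≡ c → a ≡ c + b
    a-b≡c⇒a≡c+b a b c a-b≡c = trans (sym (add-back a b)) (cong (_+ b) a-b≡c)
      where
      add-back : ∀ a b → a - b + b ≡ a
      add-back = solve-∀

  open Pushforward G φ φ-hom
  open DifferenceCounts G using (reps-pds)

  fibres≈𝟘 : ∀ {a} → toℕ (φ a) ≢ 0 → fibres ≈ζ 𝟘
  fibres≈𝟘 {a} φa≢0 = Sum.fromInj₂ (λ basis⊟𝟙≈𝟘 → contradiction basis⊟𝟙≈𝟘 (basis⊟𝟙≉𝟘 φa≢0ₚ))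
                                    (domain (basis (φ a) ⊞ ⊟ 𝟙) fibres annihilates)
    where
    φa≢0ₚ : φ a ≢ 0ₚ
    φa≢0ₚ φa≡0 = φa≢0 (trans (cong toℕ φa≡0) toℕ-0ₚ)
    annihilates : (basis (φ a) ⊞ ⊟ 𝟙) ⊛ fibres ≈ζ 𝟘
    annihilates = differ-by (+ 0) (λ l → trans (cong (_- + 0) (trans (⊛-distribʳ fibres (basis (φ a)) (⊟ 𝟙) l)
      (cong₂ _+_ (basis-⊛-fibres a l) (trans (⊟-⊛ 𝟙 fibres l) (cong -_ (⊛-identityˡ fibres l))))))
      (cong (_- + 0) (ℤ.+-inverseʳ (fibres l))))

  module RegularPDS {D : Fin v → Bool} {k lam mu : ℕ} (pds : IsPDS G D k lam mu) (reg : IsRegular G D) where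

    ξ[D] : ℤ[Cₚ]
    ξ[D] = push (λ g → ⟦ D g ⟧)

    ξ[D]⊛ξ[D] : ξ[D] ⊛ ξ[D] ≗ + mu · fibres ⊞ (+ k - + mu) · 𝟙 ⊞ (+ lam - + mu) · ξ[D]
    ξ[D]⊛ξ[D] l = begin
      (ξ[D] ⊛ ξ[D]) l
        ≡⟨ sum-cong-≗ (λ i → cong (ξ[D] i *_) (sum-cong-≗ (λ g → cong (λ b → ⟦ b ⟧ * δ (φ g) (l -ₚ i)) (sym (IsRegular.symm reg g))))) ⟩
      (ξ[D] ⊛ push (λ g → ⟦ D (g ⁻¹) ⟧)) l
        ≡⟨ push-reps D l ⟨
      push (λ g → + reps G D g) l
        ≡⟨ sum-cong-≗ (λ g → cong (_* δ (φ g) l) (reps-pds pds reg g)) ⟩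
      push (λ g → + mu + (+ k - + mu) * δ g ε + (+ lam - + mu) * ⟦ D g ⟧) l
        ≡⟨ trans (push-+ (λ g → + mu + (+ k - + mu) * δ g ε) (λ g → (+ lam - + mu) * ⟦ D g ⟧) l)
                 (cong (_+ push (λ g → (+ lam - + mu) * ⟦ D g ⟧) l) (push-+ (λ _ → + mu) (λ g → (+ k - + mu) * δ g ε) l)) ⟩
      push (λ _ → + mu) l + push (λ g → (+ k - + mu) * δ g ε) l + push (λ g → (+ lam - + mu) * ⟦ D g ⟧) l
        ≡⟨ cong₂ _+_ (cong₂ _+_ mu-fibres (trans (push-* (+ k - + mu) (λ g → δ g ε) l) (cong ((+ k - + mu) *_) (trans (push-δ ε l) (cong (λ a → δ l a) φ-ε)))))
                     (push-* (+ lam - + mu) (λ g → ⟦ D g ⟧) l) ⟩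
      (+ mu · fibres ⊞ (+ k - + mu) · 𝟙 ⊞ (+ lam - + mu) · ξ[D]) l
        ∎
      where
      open ≡-Reasoning
      mu-fibres : push (λ _ → + mu) l ≡ + mu * fibres l
      mu-fibres = trans (sum-cong-≗ (λ g → cong (_* δ (φ g) l) (sym (ℤ.*-identityʳ (+ mu))))) (push-* (+ mu) (λ _ → + 1) l)

    ξ[D]≈integer : ∀ {a} → toℕ (φ a) ≢ 0 →
                (∃ λ s → s * s ≡ (+ lam - + mu) * (+ lam - + mu) + + 4 * (+ k - + mu)) →
                ∃ λ t → ξ[D] ≈ζ t · 𝟙
    ξ[D]≈integer φa≢0 (s , s²≡Δ) =
      Sum.[ (λ ξ[D]-[e+r]≈𝟘 → e + r , ⊞⊟≈𝟘⇒≈ ξ[D]-[e+r]≈𝟘) , (λ ξ[D]+r≈𝟘 → - r , ⊞⊟≈𝟘⇒≈ ξ[D]+r≈𝟘) ]′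
        (domain (ξ[D] ⊞ ⊟ ((e + r) · 𝟙)) (ξ[D] ⊞ ⊟ ((- r) · 𝟙)) roots-annihilate)
      where
      e : ℤ
      e = + lam - + mu
      r : ℤ
      r = proj₁ (square-discriminant⇒root s e (+ k - + mu) s²≡Δ)
      er+r²≡K : e * r + r * r ≡ + k - + mu
      er+r²≡K = proj₂ (square-discriminant⇒root s e (+ k - + mu) s²≡Δ)
      open _≈ζ_ (fibres≈𝟘 φa≢0) renaming (offset to c; f-g≡offset to fibres≡c)
      vieta : ∀ m n e r u x → m * n + (e * r + r * r) * u + e * x + - (- r * x) + - ((e + r) * x) + (e + r) * - r * u ≡ m * n
      vieta = solve-∀
      roots-annihilate : (ξ[D] ⊞ ⊟ ((e + r) · 𝟙)) ⊛ (ξ[D] ⊞ ⊟ ((- r) · 𝟙)) ≈ζ 𝟘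
      roots-annihilate = differ-by (+ mu * c) λ l → begin
        ((ξ[D] ⊞ ⊟ ((e + r) · 𝟙)) ⊛ (ξ[D] ⊞ ⊟ ((- r) · 𝟙))) l - + 0
          ≡⟨ ℤ.+-identityʳ _ ⟩
        ((ξ[D] ⊞ ⊟ ((e + r) · 𝟙)) ⊛ (ξ[D] ⊞ ⊟ ((- r) · 𝟙))) l
          ≡⟨ expand-⊛ (e + r) (- r) ξ[D] ξ[D] l ⟩
        (ξ[D] ⊛ ξ[D]) l + - (- r * ξ[D] l) + - ((e + r) * ξ[D] l) + (e + r) * - r * 𝟙 l
          ≡⟨ cong (λ x → x + - (- r * ξ[D] l) + - ((e + r) * ξ[D] l) + (e + r) * - r * 𝟙 l) (ξ[D]⊛ξ[D] l) ⟩
        + mu * fibres l + (+ k - + mu) * 𝟙 l + e * ξ[D] l + - (- r * ξ[D] l) + - ((e + r) * ξ[D] l) + (e + r) * - r * 𝟙 l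
          ≡⟨ cong (λ K → + mu * fibres l + K * 𝟙 l + e * ξ[D] l + - (- r * ξ[D] l) + - ((e + r) * ξ[D] l) + (e + r) * - r * 𝟙 l) er+r²≡K ⟨
        + mu * fibres l + (e * r + r * r) * 𝟙 l + e * ξ[D] l + - (- r * ξ[D] l) + - ((e + r) * ξ[D] l) + (e + r) * - r * 𝟙 l
          ≡⟨ vieta (+ mu) (fibres l) e r (𝟙 l) (ξ[D] l) ⟩
        + mu * fibres l
          ≡⟨ cong (+ mu *_) (trans (sym (ℤ.+-identityʳ (fibres l))) (fibres≡c l)) ⟩
        + mu * c
          ∎
        where open ≡-Reasoning

    module Consequences {t : ℤ} (ξ[D]≈t : ξ[D] ≈ζ t · 𝟙) where

      open _≈ζ_ ξ[D]≈t public renaming (offset to c; f-g≡offset to ξ[D]-t≡c)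

      charSum≈ℤt : charSum G φ D ≈ℤ t
      charSum≈ℤt = c , λ i → trans (cong₂ _-_ (charSum≗ξ[D] i) (t·𝟙≡κ i)) (ξ[D]-t≡c i)
        where
        charSum≗ξ[D] : ∀ i → charSum G φ D i ≡ ξ[D] i
        charSum≗ξ[D] i = trans (card-sum (λ d → D d ∧ ⌊ φ d ≟ i ⌋)) (sum-cong-≗ (λ d → ⟦a∧b⟧≡⟦a⟧*⟦b⟧ (D d) ⌊ φ d ≟ i ⌋))
        t·𝟙≡κ : ∀ i → (if ⌊ toℕ i ℕ.≟ 0 ⌋ then t else + 0) ≡ t * 𝟙 i
        t·𝟙≡κ i = trans (if≡* ⌊ toℕ i ℕ.≟ 0 ⌋) (cong (t *_) (sym (δ≡⟦toℕ≟0⟧ i)))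
          where
          if≡* : ∀ b → (if b then t else + 0) ≡ t * ⟦ b ⟧
          if≡* true  = sym (ℤ.*-identityʳ t)
          if≡* false = sym (ℤ.*-zeroʳ t)

      k-t≡p*c : + k - t ≡ + p * c
      k-t≡p*c = begin
        + k - t                               ≡⟨ cong₂ _-_ Σξ[D]≡k Σt·𝟙≡t ⟨
        sum ξ[D] - sum (t · 𝟙)                   ≡⟨ ∑-distrib-- ξ[D] (t · 𝟙) ⟨
        ∑[ l < p ] (ξ[D] l - t * 𝟙 l)            ≡⟨ sum-cong-≗ ξ[D]-t≡c ⟩
        ∑[ l < p ] c                          ≡⟨ sum-const p c ⟩
        + p * c                               ∎
        where
        open ≡-Reasoning
        Σξ[D]≡k : sum ξ[D] ≡ + k
        Σξ[D]≡k = trans (augmentation-push (λ g → ⟦ D g ⟧)) (trans (sym (card-sum D)) (cong +_ (IsPDS.size pds)))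
        Σt·𝟙≡t : sum (t · 𝟙) ≡ t
        Σt·𝟙≡t = trans (sum-cong-≗ (λ l → ℤ.*-comm t (δ l 0ₚ))) (sum-δ 0ₚ (λ _ → t))

      p∣k-t : + p ∣ + k - t
      p∣k-t = ∣⇒∣ᵤ (divides c (trans k-t≡p*c (ℤ.*-comm (+ p) c)))

      |N∩D|≡c+t : + card (λ g → inKer G φ g ∧ D g) ≡ c + t
      |N∩D|≡c+t = begin
        + card (λ g → inKer G φ g ∧ D g) ≡⟨ card-fibre D (inKer G φ) 0ₚ (λ g → sym (δ≡⟦toℕ≟0⟧ (φ g))) ⟩
        ξ[D] 0ₚ                             ≡⟨ a-b≡c⇒a≡c+b (ξ[D] 0ₚ) (t * 𝟙 0ₚ) c (ξ[D]-t≡c 0ₚ) ⟩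
        c + t * 𝟙 0ₚ                     ≡⟨ cong (λ x → c + t * x) (δ-refl 0ₚ) ⟩
        c + t * + 1                      ≡⟨ cong (_+_ c) (ℤ.*-identityʳ t) ⟩
        c + t                            ∎
        where open ≡-Reasoning

      |Na∩D|≡c : ∀ a → inKer G φ a ≡ false → + card (λ g → inCoset G φ a g ∧ D g) ≡ c
      |Na∩D|≡c a a∉N = begin
        + card (λ g → inCoset G φ a g ∧ D g) ≡⟨ card-fibre D (inCoset G φ a) (φ a) ⟦Na⟧≡δ ⟩
        ξ[D] (φ a)                               ≡⟨ a-b≡c⇒a≡c+b (ξ[D] (φ a)) (t * 𝟙 (φ a)) c (ξ[D]-t≡c (φ a)) ⟩
        c + t * 𝟙 (φ a)                       ≡⟨ cong (λ x → c + t * x) (trans (δ≡⟦toℕ≟0⟧ (φ a)) (cong ⟦_⟧ a∉N)) ⟩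
        c + t * + 0                           ≡⟨ trans (cong (_+_ c) (ℤ.*-zeroʳ t)) (ℤ.+-identityʳ c) ⟩
        c                                     ∎
        where
        open ≡-Reasoning
        ⟦Na⟧≡δ : ∀ g → ⟦ inCoset G φ a g ⟧ ≡ δ (φ g) (φ a)
        ⟦Na⟧≡δ g = trans (sym (δ≡⟦toℕ≟0⟧ (φ (g ∙ a ⁻¹))))
          (δ-cong-⇔ (λ e → x∙y⁻¹≈ε⇒x≈y (φ g) (φ a) (trans (sym (φ-∙⁻¹ g a)) e)) (λ e → trans (φ-∙⁻¹ g a) (x≈y⇒x∙y⁻¹≈ε e)))

open import Data.Nat using (ℕ; _<_; _+_; _*_)
open import Data.Nat.Primality using (Prime; prime⇒nonZero)
open import Data.Fin using (Fin; toℕ) renaming (zero to fzero)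
open import Data.Bool using (Bool; true; false; _∧_)
open import Data.Integer using (ℤ; +_; _-_) renaming (_*_ to _*ℤ_; _+_ to _+ℤ_)
open import Data.Integer.Divisibility using () renaming (_∣_ to _∣ℤ_)
open import Data.Product using (Σ; ∃; _×_; _,_; proj₁; proj₂)
open import Relation.Nullary using (¬_)
open import Relation.Binary.PropositionalEquality using (_≡_; _≢_)

lemma3p3 : ∀ {v} (G : FiniteGroup v) (D : Fin v → Bool) (k lam mu : ℕ) →
    IsPDS G D k lam mu → IsRegular G D →
    0 < mu → mu < k →
    (∃ λ (s : ℤ) → s *ℤ s ≡ (+ lam - + mu) *ℤ (+ lam - + mu) +ℤ + 4 *ℤ (+ k - + mu)) →
    ¬ (2 * k + 1 ≡ v × 4 * lam + 5 ≡ v × 4 * mu + 1 ≡ v) →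
    (p : ℕ) (pp : Prime p) (φ : Fin v → Fin p) →
    IsHomToZp G p {{prime⇒nonZero pp}} φ →
    (∃ λ g → toℕ (φ g) ≢ 0) →
    ∃ λ (t : ℤ) → charSum G φ D ≈ℤ t ×
      (+ p ∣ℤ (+ k - t)) ×
      ∃ λ (m : ℤ) → + k - t ≡ + p *ℤ m ×
        + card (λ g → inKer G φ g ∧ D g) ≡ m +ℤ t ×
        (∀ a → inKer G φ a ≡ false → + card (λ g → inCoset G φ a g ∧ D g) ≡ m)
lemma3p3 G D k lam mu pds reg _ _ Δ-square _ p p-prime φ φ-hom (a , φa≢0) =
  t , charSum≈ℤt , p∣k-t , c , k-t≡p*c , |N∩D|≡c+t , |Na∩D|≡c
  where
  open CharacterValues G p-prime φ φ-hom
  open RegularPDS pds reg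
  t : ℤ
  t = proj₁ (ξ[D]≈integer φa≢0 Δ-square)
  open Consequences {t} (proj₂ (ξ[D]≈integer φa≢0 Δ-square))
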